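{- Let $m\ge 1$, $n=2m$, let $d\in\{1,\dots,2^m-1\}$ and let $l\in\{0,\dots,m-1\}$ be the position of the least significant one-digit in the binary expansion of $d$ (i.e. $2^l$ divides $d$ and $2^{l+1}$ does not). Let $\lambda\in\mathbb{F}_{2^m}^*$ and define $g:\mathbb{F}_{2^m}\times\mathbb{F}_{2^m}\to\mathbb{F}_2$ by $g(x,y)=\mathrm{Tr}_m(\lambda x^{2^m-d}y^d)$. Let $a$ be a primitive element of $\mathbb{F}_{2^n}$ and put $r=m-l$. Then there exist coefficients $A_1,\dots,A_{2^{r-1}}\in\mathbb{F}_{2^n}^*$ and a linear (over $\mathbb{F}_2$) function $L:\mathbb{F}_{2^n}\to\mathbb{F}_2$ such that for all $t\in\mathbb{F}_{2^n}$, \[ g\big(t+t^{2^m},\,at+a^{2^m}t^{2^m}\big)=\mathrm{Tr}_n\Bigg(A_{2^{r-1}}t^{2^m+1}+\sum_{i=1}^{2^{r-1}-1}A_i\,t^{(2^m-1)(2^{m-r}i+1)+1}\Bigg)+L(t). \]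
   Context: For $k\ge1$, $\mathrm{Tr}_k(x)=\sum_{i=0}^{k-1}x^{2^i}$ denotes the absolute trace from $\mathbb{F}_{2^k}$ to $\mathbb{F}_2$. Note $t+t^{2^m}$ and $at+a^{2^m}t^{2^m}$ lie in $\mathbb{F}_{2^m}$ for $t\in\mathbb{F}_{2^n}$. -}

module Defs where

open import Level using (0ℓ)
open import Data.Nat using (ℕ; zero; suc)
import Data.Nat as N
open import Data.Fin using (Fin)
open import Data.Product using (∃)
open import Relation.Binary.PropositionalEquality using (_≡_; _≢_)
open import Algebra.Structures using (IsCommutativeRing)
open import Function.Bundles using (_↔_)

record GF2^ (n : ℕ) : Set₁ where
  infixl 6 _+_
  infixl 7 _*_
  field
    Carrier : Set
    _+_ _*_ : Carrier → Carrier → Carrier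
    -_      : Carrier → Carrier
    0# 1#   : Carrier
    isCommutativeRing : IsCommutativeRing _≡_ _+_ _*_ -_ 0# 1#
    0≢1     : 0# ≢ 1#
    inverse : ∀ x → x ≢ 0# → ∃ λ y → x * y ≡ 1#
    card    : Carrier ↔ Fin (2 N.^ n)

  infixr 8 _^_
  _^_ : Carrier → ℕ → Carrier
  x ^ zero  = 1#
  x ^ suc k = x * (x ^ k)

  Tr : ℕ → Carrier → Carrier
  Tr zero    x = 0#
  Tr (suc k) x = Tr k x + x ^ (2 N.^ k)

  sum1to : (ℕ → Carrier) → ℕ → Carrier
  sum1to f zero    = 0#
  sum1to f (suc k) = sum1to f k + f (suc k)

  InF2 : Carrier → Set
  InF2 x = x ≡ 0# Data.Sum.⊎ x ≡ 1#
    where import Data.Sum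

  InSub : ℕ → Carrier → Set
  InSub m x = x ^ (2 N.^ m) ≡ x

  Primitive : Carrier → Set
  Primitive a = (a ^ (2 N.^ n N.∸ 1) ≡ 1#) Data.Product.×
                (∀ k → 1 N.≤ k → k N.< 2 N.^ n N.∸ 1 → a ^ k ≢ 1#)
    where import Data.Product

  gfun : ℕ → ℕ → Carrier → Carrier → Carrier → Carrier
  gfun m d lam x y = Tr m (lam * x ^ (2 N.^ m N.∸ d) * y ^ d)

module Submission where

-- Write d = D·2^l with D odd, r = m - l, K = 2^r, X = t + t̄ and Y = a t + ā t̄.
-- Then X^(q-d) Y^d = (X·P)^(2^l) with P = X^(K-1-D) Y^D.  Reading D and the
-- exponent k of t in binary, P = Σ_(k<K) γ_k t^k t̄^(K-1-k) where γ_k is a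
-- monomial a^u ā^v with u + v = D, and conjugation maps γ_k to γ_(K-1-k).  So
-- λ (X·P)^(2^l) = Σ_(i≤K) W_i, W_i = λ (c_i t^i t̄^(K-i))^(2^l), c_i = γ_(i-1) + γ_i,
-- is a conjugation-symmetric sum.  Folding it under Tr_m, each pair {i, K-i}
-- with 0 < i < K/2 gives Tr_n(A_i t^(E_i)), the middle term gives
-- Tr_n(A t^(q+1)) via an element θ with θ + θ̄ = 1, and the ends give the
-- F_2-linear form L.  The coefficients are nonzero since neighbouring γ's
-- differ: for odd D their exponents of a have different parities, and distinct
-- monomials a^u ā^v of degree < q are distinct because a is primitive.

open import Defs
open import Data.Nat using (ℕ)
import Data.Nat as N
open import Data.Nat.Divisibility using (_∣_)
open import Data.Product using (∃; _×_)
open import Relation.Nullary using (¬_)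
open import Relation.Binary.PropositionalEquality using (_≡_; _≢_)

open import Data.Nat using (zero; suc; NonZero; ≢-nonZero)
import Data.Nat.Properties as NP
open import Data.Nat.Divisibility using (divides; ∣⇒≤; *-cancelˡ-∣; m%n≡0⇒n∣m)
open import Data.Nat.DivMod using (_%_; _/_; m≡m%n+[m/n]*n; m%n<n)
open import Data.Nat.Solver using (module +-*-Solver)
open import Data.Bool using (Bool; true; false; not; _∧_)
open import Data.Fin using (Fin; toℕ; punchOut) renaming (_≟_ to _≟Fin_)
import Data.Fin.Properties as FP
open import Data.Product using (_,_; proj₁; proj₂)
open import Data.Sum using (inj₁; inj₂; [_,_])
open import Data.Empty using (⊥-elim)
open import Relation.Nullary using (Dec; yes; no)
open import Relation.Binary.PropositionalEquality
  using (refl; sym; trans; cong; cong₂; subst; subst₂; module ≡-Reasoning)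
open import Relation.Binary.Definitions using (tri<; tri≈; tri>)
open import Function.Bundles using (Inverse; Injection)
open import Function.Properties.Inverse using (↔⇒↣)
open import Data.Maybe using (nothing)
open import Algebra.Bundles using (CommutativeSemiring; Ring)
open import Algebra.Structures using (IsCommutativeRing)

module Digits where
  open +-*-Solver using (solve; _:+_; _:*_; _:=_; con)

  ⟦_⟧ : Bool → ℕ
  ⟦ false ⟧ = 0
  ⟦ true ⟧ = 1

  bit : ℕ → Bool
  bit zero = false
  bit (suc zero) = true
  bit (suc (suc k)) = bit k

  half : ℕ → ℕ
  half zero = zero
  half (suc zero) = zero
  half (suc (suc k)) = suc (half k)

  bit-half : ∀ k → ⟦ bit k ⟧ N.+ (half k N.+ half k) ≡ k
  bit-half zero = refl
  bit-half (suc zero) = refl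
  bit-half (suc (suc k)) = trans (lemma (bit k) (half k)) (cong (λ k → suc (suc k)) (bit-half k))
    where
    lemma : ∀ b h → ⟦ b ⟧ N.+ (suc h N.+ suc h) ≡ suc (suc (⟦ b ⟧ N.+ (h N.+ h)))
    lemma b h = solve 2 (λ b h → b :+ ((con 1 :+ h) :+ (con 1 :+ h)) := con 2 :+ (b :+ (h :+ h))) refl ⟦ b ⟧ h

  bit-digits : ∀ b h → bit (⟦ b ⟧ N.+ (h N.+ h)) ≡ b
  bit-digits false zero = refl
  bit-digits true zero = refl
  bit-digits b (suc h) rewrite NP.+-suc h h with b
  ... | false = bit-digits false h
  ... | true = bit-digits true h

  half-digits : ∀ b h → half (⟦ b ⟧ N.+ (h N.+ h)) ≡ h
  half-digits false zero = refl
  half-digits true zero = refl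
  half-digits b (suc h) rewrite NP.+-suc h h with b
  ... | false = cong suc (half-digits false h)
  ... | true = cong suc (half-digits true h)

  bit-suc : ∀ k → bit (suc k) ≡ not (bit k)
  bit-suc zero = refl
  bit-suc (suc zero) = refl
  bit-suc (suc (suc k)) = bit-suc k

  -- splitting the digit b between two numbers according to a second digit p
  digit-split : ∀ b p u v → ⟦ b ∧ p ⟧ N.+ (u N.+ u) N.+ (⟦ b ∧ not p ⟧ N.+ (v N.+ v)) ≡ ⟦ b ⟧ N.+ ((u N.+ v) N.+ (u N.+ v))
  digit-split false p u v = solve 2 (λ u v → (u :+ u) :+ (v :+ v) := (u :+ v) :+ (u :+ v)) refl u v
  digit-split true true u v = solve 2 (λ u v → con 1 :+ (u :+ u) :+ (v :+ v) := con 1 :+ ((u :+ v) :+ (u :+ v))) refl u v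
  digit-split true false u v = solve 2 (λ u v → (u :+ u) :+ (con 1 :+ (v :+ v)) := con 1 :+ ((u :+ v) :+ (u :+ v))) refl u v

  half-bound : ∀ b h j → ⟦ b ⟧ N.+ (h N.+ h) N.< 2 N.^ suc j → h N.< 2 N.^ j
  half-bound b h j lt = NP.*-cancelˡ-< 2 h (2 N.^ j) (NP.≤-<-trans 2h≤ lt)
    where
    2h≤ : 2 N.* h N.≤ ⟦ b ⟧ N.+ (h N.+ h)
    2h≤ = NP.≤-trans (NP.≤-reflexive (cong (h N.+_) (NP.+-identityʳ h))) (NP.m≤n+m (h N.+ h) ⟦ b ⟧)

  half-below : ∀ j k → k N.< 2 N.^ suc j → half k N.< 2 N.^ j
  half-below j k k< = half-bound (bit k) (half k) j (subst (N._< 2 N.^ suc j) (sym (bit-half k)) k<)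

  by-digits : ∀ (P : ℕ → Set) j k → k N.< 2 N.^ suc j →
              (∀ b h → h N.< 2 N.^ j → P (⟦ b ⟧ N.+ (h N.+ h))) → P k
  by-digits P j k k< step = subst P (bit-half k)
    (step (bit k) (half k) (half-below j k k<))

  pow2-suc : ∀ k → 2 N.^ k ≡ suc (2 N.^ k N.∸ 1)
  pow2-suc k with 2 N.^ k | NP.m^n>0 2 k
  ... | suc p | _ = refl

  pow2-pred-odd : ∀ k → 1 N.≤ k → ∃ λ h → 2 N.^ k N.∸ 1 ≡ suc (2 N.* h)
  pow2-pred-odd (suc k) _ = 2 N.^ k N.∸ 1 ,
    trans (cong (λ p → 2 N.* p N.∸ 1) (pow2-suc k))
          (solve 1 (λ p → p :+ con 1 :* (con 1 :+ p) := con 1 :+ con 2 :* p) refl (2 N.^ k N.∸ 1))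

  compl : ℕ → ℕ → ℕ
  compl j k = (2 N.^ j N.∸ 1) N.∸ k

  compl-split : ∀ j k → k N.< 2 N.^ j → 2 N.^ j ≡ suc (k N.+ compl j k)
  compl-split j k k< = trans (pow2-suc j)
    (cong suc (sym (NP.m+[n∸m]≡n (NP.≤-pred (subst (suc k N.≤_) (pow2-suc j) k<)))))

  compl-bound : ∀ j k → k N.< 2 N.^ j → compl j k N.< 2 N.^ j
  compl-bound j k k< = subst (compl j k N.<_) (sym (compl-split j k k<)) (N.s≤s (NP.m≤n+m _ k))

  compl-sub : ∀ j k → k N.< 2 N.^ j → 2 N.^ j N.∸ k ≡ suc (compl j k)
  compl-sub j k k< = trans (cong (N._∸ k) (compl-split j k k<))
    (trans (cong (N._∸ k) (sym (NP.+-suc k _))) (NP.m+n∸m≡n k _))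

  compl-digits : ∀ j b h → h N.< 2 N.^ j →
                 compl (suc j) (⟦ b ⟧ N.+ (h N.+ h)) ≡ ⟦ not b ⟧ N.+ (compl j h N.+ compl j h)
  compl-digits j b h h< = trans (cong (λ P → (2 N.* P N.∸ 1) N.∸ (⟦ b ⟧ N.+ (h N.+ h))) (compl-split j h h<)) (flip b)
    where
    e = compl j h
    flip : ∀ b → (2 N.* suc (h N.+ e) N.∸ 1) N.∸ (⟦ b ⟧ N.+ (h N.+ h)) ≡ ⟦ not b ⟧ N.+ (e N.+ e)
    flip false = trans (cong (N._∸ (h N.+ h)) (solve 2 (λ h e → (h :+ e) :+ ((con 1 :+ (h :+ e)) :+ con 0) := (h :+ h) :+ (con 1 :+ (e :+ e))) refl h e))
                       (NP.m+n∸m≡n (h N.+ h) (suc (e N.+ e)))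
    flip true = trans (cong (N._∸ suc (h N.+ h)) (solve 2 (λ h e → (h :+ e) :+ ((con 1 :+ (h :+ e)) :+ con 0) := (con 1 :+ (h :+ h)) :+ (e :+ e)) refl h e))
                      (NP.m+n∸m≡n (suc (h N.+ h)) (e N.+ e))

module FieldArith {n : ℕ} (F : GF2^ n) where
  open GF2^ F public
  open IsCommutativeRing isCommutativeRing public
    using (+-assoc; +-comm; *-assoc; *-comm; +-identityˡ; +-identityʳ; *-identityˡ; *-identityʳ;
           distribˡ; distribʳ; zeroˡ; zeroʳ; -‿inverseʳ)

  semiring : CommutativeSemiring _ _
  semiring = record { isCommutativeSemiring = IsCommutativeRing.isCommutativeSemiring isCommutativeRing }
  open import Algebra.Solver.Ring.NaturalCoefficients semiring (λ _ _ → nothing) public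
    using (solve; _:+_; _:*_; _:=_)
  import Algebra.Properties.CommutativeSemiring.Exp semiring as Exp

  ^-std : ∀ x k → x ^ k ≡ x Exp.^ k
  ^-std x zero = refl
  ^-std x (suc k) = cong (x *_) (^-std x k)

  ^-+ : ∀ x i j → x ^ (i N.+ j) ≡ x ^ i * x ^ j
  ^-+ x i j = trans (^-std x (i N.+ j)) (trans (Exp.^-homo-* x i j) (sym (cong₂ _*_ (^-std x i) (^-std x j))))

  ^-* : ∀ x i j → x ^ (i N.* j) ≡ (x ^ i) ^ j
  ^-* x i j = trans (^-std x (i N.* j)) (trans (sym (Exp.^-assocʳ x i j)) (sym (trans (^-std _ j) (cong (Exp._^ j) (^-std x i)))))

  *-^ : ∀ x y k → (x * y) ^ k ≡ x ^ k * y ^ k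
  *-^ x y k = trans (^-std (x * y) k) (trans (Exp.^-distrib-* x y k) (sym (cong₂ _*_ (^-std x k) (^-std y k))))

  1^ : ∀ j → 1# ^ j ≡ 1#
  1^ zero = refl
  1^ (suc j) = trans (*-identityˡ _) (1^ j)

  ^-comm : ∀ x i j → (x ^ i) ^ j ≡ (x ^ j) ^ i
  ^-comm x i j = trans (sym (^-* x i j)) (trans (cong (x ^_) (NP.*-comm i j)) (^-* x j i))

  sq : ∀ x → x ^ 2 ≡ x * x
  sq x = cong (x *_) (*-identityʳ x)

  1≢0 : 1# ≢ 0#
  1≢0 e = 0≢1 (sym e)

  cancel : ∀ {x y z} → x ≢ 0# → x * y ≡ x * z → y ≡ z
  cancel {x} {y} {z} x≢0 e with inverse x x≢0
  ... | x⁻¹ , xx⁻¹ = begin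
      y                ≡⟨ sym (*-identityˡ y) ⟩
      1# * y           ≡⟨ cong (_* y) (sym xx⁻¹) ⟩
      (x * x⁻¹) * y    ≡⟨ solve 3 (λ x x⁻¹ y → (x :* x⁻¹) :* y := x⁻¹ :* (x :* y)) refl x x⁻¹ y ⟩
      x⁻¹ * (x * y)    ≡⟨ cong (x⁻¹ *_) e ⟩
      x⁻¹ * (x * z)    ≡⟨ solve 3 (λ x x⁻¹ z → x⁻¹ :* (x :* z) := (x :* x⁻¹) :* z) refl x x⁻¹ z ⟩
      (x * x⁻¹) * z    ≡⟨ cong (_* z) xx⁻¹ ⟩
      1# * z           ≡⟨ *-identityˡ z ⟩
      z                ∎
    where open ≡-Reasoning

  nz-* : ∀ {x y} → x ≢ 0# → y ≢ 0# → x * y ≢ 0#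
  nz-* {x} x≢0 y≢0 e = y≢0 (cancel x≢0 (trans e (sym (zeroʳ x))))

  nz-^ : ∀ {x} k → x ≢ 0# → x ^ k ≢ 0#
  nz-^ zero x≢0 = 1≢0
  nz-^ (suc k) x≢0 = nz-* x≢0 (nz-^ k x≢0)

  _≟F_ : (x y : Carrier) → Dec (x ≡ y)
  x ≟F y with Inverse.to card x ≟Fin Inverse.to card y
  ... | yes e = yes (Injection.injective (↔⇒↣ card) e)
  ... | no ne = no (λ e → ne (cong (Inverse.to card) e))

  idempotent : ∀ w → w ^ 2 ≡ w → InF2 w
  idempotent w e with w ≟F 0#
  ... | yes w≡0 = inj₁ w≡0
  ... | no w≢0 = inj₂ (cancel w≢0 (trans (sym (sq w)) (trans e (sym (*-identityʳ w)))))

  Σ< : (ℕ → Carrier) → ℕ → Carrier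
  Σ< f zero = 0#
  Σ< f (suc k) = Σ< f k + f k

  Σ<-cong : ∀ {f g} K → (∀ k → k N.< K → f k ≡ g k) → Σ< f K ≡ Σ< g K
  Σ<-cong zero h = refl
  Σ<-cong (suc K) h = cong₂ _+_ (Σ<-cong K (λ k k< → h k (NP.m≤n⇒m≤1+n k<))) (h K (NP.n<1+n K))

  Σ<-*ˡ : ∀ x f K → x * Σ< f K ≡ Σ< (λ k → x * f k) K
  Σ<-*ˡ x f zero = zeroʳ x
  Σ<-*ˡ x f (suc K) = trans (distribˡ x _ _) (cong (_+ x * f K) (Σ<-*ˡ x f K))

  Σ<-pairs : ∀ h K → Σ< h (K N.+ K) ≡ Σ< (λ k → h (k N.+ k) + h (suc (k N.+ k))) K
  Σ<-pairs h zero = refl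
  Σ<-pairs h (suc K) rewrite NP.+-suc K K =
    trans (+-assoc _ _ _) (cong (_+ (h (K N.+ K) + h (suc (K N.+ K)))) (Σ<-pairs h K))

  Σ<-front : ∀ f K → Σ< f (suc K) ≡ f 0 + Σ< (λ k → f (suc k)) K
  Σ<-front f zero = trans (+-identityˡ _) (sym (+-identityʳ _))
  Σ<-front f (suc K) = trans (cong (_+ f (suc K)) (Σ<-front f K)) (+-assoc _ _ _)

  -- summation by parts: Σ_{k<K} g_k (h_{k+1} + h_k) + g_K h_K
  --                   = Σ_{i≤K} (g_{i-1} + g_i) h_i   (with g_{-1} = 0)
  Δ : (ℕ → Carrier) → ℕ → Carrier
  Δ g zero = g 0
  Δ g (suc i) = g i + g (suc i)

  Σ<-by-parts : ∀ (g h : ℕ → Carrier) K →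
                Σ< (λ k → g k * (h (suc k) + h k)) K + g K * h K ≡ Σ< (λ i → Δ g i * h i) (suc K)
  Σ<-by-parts g h zero = refl
  Σ<-by-parts g h (suc K) = trans
    (solve 5 (λ S gK gK1 hK hK1 → (S :+ gK :* (hK1 :+ hK)) :+ gK1 :* hK1 := (S :+ gK :* hK) :+ (gK :+ gK1) :* hK1) refl
       (Σ< (λ k → g k * (h (suc k) + h k)) K) (g K) (g (suc K)) (h K) (h (suc K)))
    (cong (_+ (g K + g (suc K)) * h (suc K)) (Σ<-by-parts g h K))

  Σ<-fold : ∀ f H → Σ< f (suc (H N.+ H)) ≡ f H + Σ< (λ i → f i + f ((H N.+ H) N.∸ i)) H
  Σ<-fold f zero = trans (+-identityˡ _) (sym (+-identityʳ _))
  Σ<-fold f (suc H) = begin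
      Σ< f (suc (suc H N.+ suc H))
        ≡⟨ cong (λ z → Σ< f (suc z)) (NP.+-suc (suc H) H) ⟩
      Σ< f (suc (suc (suc (H N.+ H))))
        ≡⟨ Σ<-front f (suc (suc (H N.+ H))) ⟩
      f 0 + (Σ< (λ k → f (suc k)) (suc (H N.+ H)) + f last)
        ≡⟨ cong (λ z → f 0 + (z + f last)) (Σ<-fold (λ k → f (suc k)) H) ⟩
      f 0 + ((f (suc H) + inner) + f last)
        ≡⟨ solve 4 (λ A B S C → A :+ ((B :+ S) :+ C) := B :+ ((A :+ C) :+ S)) refl (f 0) (f (suc H)) inner (f last) ⟩
      f (suc H) + ((f 0 + f last) + inner)
        ≡⟨ cong (λ z → f (suc H) + ((f 0 + f z) + inner)) (sym lastEq) ⟩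
      f (suc H) + ((f 0 + f (suc H N.+ suc H)) + inner)
        ≡⟨ cong (λ z → f (suc H) + ((f 0 + f (suc H N.+ suc H)) + z)) (Σ<-cong H (λ i i< → cong (λ z → f (suc i) + f z) (shiftEq i i<))) ⟩
      f (suc H) + ((f 0 + f (suc H N.+ suc H)) + Σ< (λ i → f (suc i) + f ((suc H N.+ suc H) N.∸ suc i)) H)
        ≡⟨ cong (f (suc H) +_) (sym (Σ<-front (λ i → f i + f ((suc H N.+ suc H) N.∸ i)) H)) ⟩
      f (suc H) + Σ< (λ i → f i + f ((suc H N.+ suc H) N.∸ i)) (suc H) ∎
    where
    open ≡-Reasoning
    last = suc (suc (H N.+ H))
    inner = Σ< (λ i → f (suc i) + f (suc ((H N.+ H) N.∸ i))) H
    lastEq : suc H N.+ suc H ≡ last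
    lastEq = cong suc (NP.+-suc H H)
    shiftEq : ∀ i → i N.< H → suc ((H N.+ H) N.∸ i) ≡ (suc H N.+ suc H) N.∸ suc i
    shiftEq i i< = trans (sym (NP.+-∸-assoc 1 (NP.≤-trans (NP.<⇒≤ i<) (NP.m≤m+n H H)))) (cong (N._∸ i) (sym (NP.+-suc H H)))

  sum1to≡Σ< : ∀ f N → sum1to f N ≡ Σ< (λ i → f (suc i)) N
  sum1to≡Σ< f zero = refl
  sum1to≡Σ< f (suc N) = cong (_+ f (suc N)) (sum1to≡Σ< f N)

  truncate : ℕ → (ℕ → Carrier) → ℕ → Carrier
  truncate K f k with k N.<? K
  ... | yes _ = f k
  ... | no _ = 0#

  truncate-below : ∀ K f k → k N.< K → truncate K f k ≡ f k
  truncate-below K f k k< with k N.<? K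
  ... | yes _ = refl
  ... | no k≮K = ⊥-elim (k≮K k<)

  truncate-at : ∀ K f → truncate K f K ≡ 0#
  truncate-at K f with K N.<? K
  ... | yes K<K = ⊥-elim (NP.<-irrefl refl K<K)
  ... | no _ = refl

  override : ℕ → Carrier → (ℕ → Carrier) → ℕ → Carrier
  override H x g i with i N.≟ H
  ... | yes _ = x
  ... | no _ = g i

  override-at : ∀ H x g → override H x g H ≡ x
  override-at H x g with H N.≟ H
  ... | yes _ = refl
  ... | no H≢H = ⊥-elim (H≢H refl)

  override-other : ∀ H x g i → i ≢ H → override H x g i ≡ g i
  override-other H x g i i≢H with i N.≟ H
  ... | yes i≡H = ⊥-elim (i≢H i≡H)
  ... | no _ = refl

injective⇒surjective : ∀ K (f : Fin K → Fin K) → (∀ i j → f i ≡ f j → i ≡ j) → ∀ y → ∃ λ i → f i ≡ y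
injective⇒surjective zero f inj ()
injective⇒surjective (suc K) f inj y with FP.any? (λ i → f i ≟Fin y)
... | yes hit = hit
... | no miss with FP.pigeonhole (NP.n<1+n K) (λ i → punchOut {i = y} {j = f i} (λ e → miss (i , sym e)))
... | i , j , i<j , e =
  ⊥-elim (FP.<⇒≢ i<j (inj i j (FP.punchOut-injective (λ e' → miss (i , sym e')) (λ e' → miss (j , sym e')) e)))

-- A primitive element a of GF2^ n (n ≥ 1) lists the nonzero elements as
-- a^0, …, a^(2^n-2).
module PrimitiveElement {n : ℕ} (F : GF2^ n) (n≥1 : 1 N.≤ n) (a : GF2^.Carrier F) (prim : GF2^.Primitive F a) where
  open FieldArith F
  open Digits using (pow2-suc; pow2-pred-odd)

  ord : ℕ
  ord = 2 N.^ n N.∸ 1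

  ord≥1 : 1 N.≤ ord
  ord≥1 = NP.≤-pred (subst (2 N.≤_) (pow2-suc n) (NP.^-monoʳ-≤ 2 n≥1))

  instance
    ord-nonZero : NonZero ord
    ord-nonZero = ≢-nonZero (λ e → NP.<⇒≢ ord≥1 (sym e))

  a^ord : a ^ ord ≡ 1#
  a^ord = proj₁ prim

  a≢0 : a ≢ 0#
  a≢0 e with ord | ord≥1 | a^ord
  ... | suc k | _ | a^ord' = 1≢0 (trans (sym a^ord') (trans (cong (_^ suc k) e) (zeroˡ _)))

  a^-mod : ∀ X → a ^ X ≡ a ^ (X % ord)
  a^-mod X = begin
      a ^ X                                ≡⟨ cong (a ^_) (m≡m%n+[m/n]*n X ord) ⟩
      a ^ (X % ord N.+ (X / ord) N.* ord)  ≡⟨ ^-+ a (X % ord) _ ⟩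
      a ^ (X % ord) * a ^ ((X / ord) N.* ord)
        ≡⟨ cong (a ^ (X % ord) *_) (trans (^-* a (X / ord) ord) (trans (^-comm a (X / ord) ord) (cong (_^ (X / ord)) a^ord))) ⟩
      a ^ (X % ord) * 1# ^ (X / ord)       ≡⟨ cong (a ^ (X % ord) *_) (1^ (X / ord)) ⟩
      a ^ (X % ord) * 1#                   ≡⟨ *-identityʳ _ ⟩
      a ^ (X % ord)                        ∎
    where open ≡-Reasoning

  order-divides : ∀ X → a ^ X ≡ 1# → ord ∣ X
  order-divides X e = m%n≡0⇒n∣m X ord (remainder-zero (X % ord) refl)
    where
    remainder-zero : ∀ y → y ≡ X % ord → y ≡ 0
    remainder-zero zero _ = refl
    remainder-zero (suc y) y≡ = ⊥-elim (proj₂ prim (suc y) (N.s≤s N.z≤n)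
      (subst (N._< ord) (sym y≡) (m%n<n X ord)) (subst (λ z → a ^ z ≡ 1#) (sym y≡) (trans (sym (a^-mod X)) e)))

  power-gap : ∀ {i j} → i N.< j → j N.< ord → a ^ i ≢ a ^ j
  power-gap {i} {j} i<j j< e = proj₂ prim (j N.∸ i) (NP.m<n⇒0<n∸m i<j) (NP.≤-<-trans (NP.m∸n≤m j i) j<)
    (sym (cancel (nz-^ i a≢0) (begin
      a ^ i * 1#             ≡⟨ *-identityʳ _ ⟩
      a ^ i                  ≡⟨ e ⟩
      a ^ j                  ≡⟨ cong (a ^_) (sym (NP.m+[n∸m]≡n (NP.<⇒≤ i<j))) ⟩
      a ^ (i N.+ (j N.∸ i))  ≡⟨ ^-+ a i (j N.∸ i) ⟩
      a ^ i * a ^ (j N.∸ i)  ∎)))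
    where open ≡-Reasoning

  a^-injective : ∀ i j → i N.< ord → j N.< ord → a ^ i ≡ a ^ j → i ≡ j
  a^-injective i j i< j< e with NP.<-cmp i j
  ... | tri≈ _ i≡j _ = i≡j
  ... | tri< i<j _ _ = ⊥-elim (power-gap i<j j< e)
  ... | tri> _ _ j<i = ⊥-elim (power-gap j<i i< (sym e))

  listing : ℕ → Carrier
  listing zero = 0#
  listing (suc k) = a ^ k

  listing-injective : ∀ i j → i N.< 2 N.^ n → j N.< 2 N.^ n → listing i ≡ listing j → i ≡ j
  listing-injective zero zero _ _ e = refl
  listing-injective zero (suc j) _ _ e = ⊥-elim (nz-^ j a≢0 (sym e))
  listing-injective (suc i) zero _ _ e = ⊥-elim (nz-^ i a≢0 e)
  listing-injective (suc i) (suc j) i< j< e =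
    cong suc (a^-injective i j (below i i<) (below j j<) e)
    where
    below : ∀ k → suc k N.< 2 N.^ n → k N.< ord
    below k k< = NP.≤-pred (subst (suc k N.<_) (pow2-suc n) k<)

  every-nonzero-power : ∀ x → x ≢ 0# → ∃ λ k → k N.< ord × a ^ k ≡ x
  every-nonzero-power x x≢0 with injective⇒surjective (2 N.^ n) code code-injective (Inverse.to card x)
    where
    code : Fin (2 N.^ n) → Fin (2 N.^ n)
    code i = Inverse.to card (listing (toℕ i))
    code-injective : ∀ i j → code i ≡ code j → i ≡ j
    code-injective i j e = FP.toℕ-injective (listing-injective (toℕ i) (toℕ j) (FP.toℕ<n i) (FP.toℕ<n j)
      (Injection.injective (↔⇒↣ card) e))
  ... | i , e with toℕ i | FP.toℕ<n i | Injection.injective (↔⇒↣ card) e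
  ... | zero | _ | 0≡x = ⊥-elim (x≢0 (sym 0≡x))
  ... | suc k | k< | a^k≡x = k , NP.≤-pred (subst (suc k N.<_) (pow2-suc n) k<) , a^k≡x

  fermat : ∀ x → x ^ (2 N.^ n) ≡ x
  fermat x with x ≟F 0#
  ... | yes x≡0 rewrite x≡0 | pow2-suc n = zeroˡ _
  ... | no x≢0 with every-nonzero-power x x≢0
  ... | k , _ , a^k≡x = begin
      x ^ (2 N.^ n)        ≡⟨ cong (x ^_) (pow2-suc n) ⟩
      x * x ^ ord          ≡⟨ cong (λ z → x * z ^ ord) (sym a^k≡x) ⟩
      x * (a ^ k) ^ ord    ≡⟨ cong (x *_) (trans (^-comm a k ord) (cong (_^ k) a^ord)) ⟩
      x * 1# ^ k           ≡⟨ cong (x *_) (1^ k) ⟩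
      x * 1#               ≡⟨ *-identityʳ x ⟩
      x                    ∎
    where open ≡-Reasoning

  -- the characteristic is 2: -1 = a^k with a^(2k) = 1 forces k = 0,
  -- since ord ∣ 2k, 2k < 2·ord and ord is odd
  -1≢0 : - 1# ≢ 0#
  -1≢0 e = 1≢0 (trans (sym (+-identityʳ 1#)) (trans (cong (1# +_) (sym e)) (-‿inverseʳ 1#)))

  -1*-1 : - 1# * - 1# ≡ 1#
  -1*-1 = trans (-1*x≈-x (- 1#)) (-‿involutive 1#)
    where
    ring : Ring _ _
    ring = record { isRing = IsCommutativeRing.isRing isCommutativeRing }
    open import Algebra.Properties.Ring ring using (-1*x≈-x; -‿involutive)

  char2 : 1# + 1# ≡ 0#
  char2 with every-nonzero-power (- 1#) -1≢0
  ... | k , k< , a^k≡-1 = trans (cong (1# +_) (trans (cong (a ^_) (sym k≡0)) a^k≡-1)) (-‿inverseʳ 1#)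
    where
    a^2k : a ^ (k N.+ k) ≡ 1#
    a^2k = trans (^-+ a k k) (trans (cong₂ _*_ a^k≡-1 a^k≡-1) -1*-1)
    k≡0 : k ≡ 0
    k≡0 with order-divides (k N.+ k) a^2k
    ... | divides zero 2k≡0 = NP.m+n≡0⇒m≡0 k 2k≡0
    ... | divides (suc zero) 2k≡ord = ⊥-elim (NP.even≢odd k (proj₁ (pow2-pred-odd n n≥1))
          (trans (cong (k N.+_) (NP.+-identityʳ k)) (trans 2k≡ord (trans (NP.+-identityʳ ord) (proj₂ (pow2-pred-odd n n≥1))))))
    ... | divides (suc (suc c)) 2k≡ = ⊥-elim (NP.<-irrefl 2k≡
          (NP.<-≤-trans (NP.+-mono-< k< k<) (NP.+-monoʳ-≤ ord (NP.m≤m+n ord (c N.* ord)))))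

-- In characteristic 2 squaring is additive, hence so are the Frobenius
-- powers x ↦ x^(2^k) and the traces Tr_k.
module Char2 {n : ℕ} (F : GF2^ n) (char2 : GF2^._+_ F (GF2^.1# F) (GF2^.1# F) ≡ GF2^.0# F) where
  open FieldArith F
  open Digits using (pow2-suc)

  x+x : ∀ x → x + x ≡ 0#
  x+x x = begin
      x + x                ≡⟨ cong₂ _+_ (sym (*-identityˡ x)) (sym (*-identityˡ x)) ⟩
      1# * x + 1# * x      ≡⟨ sym (distribʳ x 1# 1#) ⟩
      (1# + 1#) * x        ≡⟨ cong (_* x) char2 ⟩
      0# * x               ≡⟨ zeroˡ x ⟩
      0#                   ∎
    where open ≡-Reasoning

  sum≡0 : ∀ {x y} → x + y ≡ 0# → x ≡ y
  sum≡0 {x} {y} e = begin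
      x                ≡⟨ sym (+-identityʳ x) ⟩
      x + 0#           ≡⟨ cong (x +_) (sym (x+x y)) ⟩
      x + (y + y)      ≡⟨ sym (+-assoc x y y) ⟩
      (x + y) + y      ≡⟨ cong (_+ y) e ⟩
      0# + y           ≡⟨ +-identityˡ y ⟩
      y                ∎
    where open ≡-Reasoning

  +-cancelʳ : ∀ {x y} z → x + z ≡ y + z → x ≡ y
  +-cancelʳ {x} {y} z e = sum≡0 (begin
      x + y                  ≡⟨ cong (x +_) (sym (+-identityʳ y)) ⟩
      x + (y + 0#)           ≡⟨ cong (λ w → x + (y + w)) (sym (x+x z)) ⟩
      x + (y + (z + z))      ≡⟨ solve 3 (λ x y z → x :+ (y :+ (z :+ z)) := (x :+ z) :+ (y :+ z)) refl x y z ⟩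
      (x + z) + (y + z)      ≡⟨ cong (_+ (y + z)) e ⟩
      (y + z) + (y + z)      ≡⟨ x+x (y + z) ⟩
      0#                     ∎)
    where open ≡-Reasoning

  sq-+ : ∀ x y → (x + y) ^ 2 ≡ x ^ 2 + y ^ 2
  sq-+ x y = begin
      (x + y) ^ 2                       ≡⟨ sq (x + y) ⟩
      (x + y) * (x + y)                 ≡⟨ solve 2 (λ x y → (x :+ y) :* (x :+ y) := (x :* x :+ y :* y) :+ (x :* y :+ x :* y)) refl x y ⟩
      (x * x + y * y) + (x * y + x * y) ≡⟨ cong ((x * x + y * y) +_) (x+x (x * y)) ⟩
      (x * x + y * y) + 0#              ≡⟨ +-identityʳ _ ⟩
      x * x + y * y                     ≡⟨ sym (cong₂ _+_ (sq x) (sq y)) ⟩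
      x ^ 2 + y ^ 2                     ∎
    where open ≡-Reasoning

  frob : ∀ k x y → (x + y) ^ (2 N.^ k) ≡ x ^ (2 N.^ k) + y ^ (2 N.^ k)
  frob zero x y = distribʳ 1# x y
  frob (suc k) x y = begin
      (x + y) ^ (2 N.* 2 N.^ k)                    ≡⟨ ^-* (x + y) 2 (2 N.^ k) ⟩
      ((x + y) ^ 2) ^ (2 N.^ k)                    ≡⟨ cong (_^ (2 N.^ k)) (sq-+ x y) ⟩
      (x ^ 2 + y ^ 2) ^ (2 N.^ k)                  ≡⟨ frob k (x ^ 2) (y ^ 2) ⟩
      (x ^ 2) ^ (2 N.^ k) + (y ^ 2) ^ (2 N.^ k)    ≡⟨ sym (cong₂ _+_ (^-* x 2 (2 N.^ k)) (^-* y 2 (2 N.^ k))) ⟩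
      x ^ (2 N.* 2 N.^ k) + y ^ (2 N.* 2 N.^ k)    ∎
    where open ≡-Reasoning

  0^2^ : ∀ k → 0# ^ (2 N.^ k) ≡ 0#
  0^2^ k rewrite pow2-suc k = zeroˡ _

  Σ<-frob : ∀ k f K → (Σ< f K) ^ (2 N.^ k) ≡ Σ< (λ i → f i ^ (2 N.^ k)) K
  Σ<-frob k f zero = 0^2^ k
  Σ<-frob k f (suc K) = trans (frob k _ _) (cong (_+ f K ^ (2 N.^ k)) (Σ<-frob k f K))

  Tr-+ : ∀ k x y → Tr k (x + y) ≡ Tr k x + Tr k y
  Tr-+ zero x y = sym (+-identityˡ 0#)
  Tr-+ (suc k) x y rewrite Tr-+ k x y | frob k x y =
    solve 4 (λ A B C D → (A :+ B) :+ (C :+ D) := (A :+ C) :+ (B :+ D)) refl _ _ _ _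

  Tr-0 : ∀ k → Tr k 0# ≡ 0#
  Tr-0 zero = refl
  Tr-0 (suc k) rewrite Tr-0 k | 0^2^ k = +-identityˡ 0#

  Tr-Σ< : ∀ k f K → Tr k (Σ< f K) ≡ Σ< (λ i → Tr k (f i)) K
  Tr-Σ< k f zero = Tr-0 k
  Tr-Σ< k f (suc K) = trans (Tr-+ k _ _) (cong (_+ Tr k (f K)) (Tr-Σ< k f K))

  Tr-split : ∀ j k x → Tr (j N.+ k) x ≡ Tr j x + Tr k (x ^ (2 N.^ j))
  Tr-split j zero x rewrite NP.+-identityʳ j = sym (+-identityʳ _)
  Tr-split j (suc k) x rewrite NP.+-suc j k | Tr-split j k x =
    trans (+-assoc _ _ _) (cong (λ z → Tr j x + (Tr k (x ^ (2 N.^ j)) + z))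
      (trans (cong (x ^_) (NP.^-distribˡ-+-* 2 j k)) (^-* x (2 N.^ j) (2 N.^ k))))

  Tr-sq : ∀ k z → (Tr k z) ^ 2 ≡ Tr k (z ^ 2)
  Tr-sq zero z = zeroˡ _
  Tr-sq (suc k) z = trans (sq-+ _ _) (cong₂ _+_ (Tr-sq k z) (^-comm z (2 N.^ k) 2))

-- The conjugation z̄ = z^q (q = 2^m) of GF2^ (2m) over its subfield of order q:
-- an additive, multiplicative involution whose fixed points form the subfield.
module Conjugation (m : ℕ) (F : GF2^ (2 N.* m))
    (char2 : GF2^._+_ F (GF2^.1# F) (GF2^.1# F) ≡ GF2^.0# F)
    (fermat : ∀ x → GF2^._^_ F x (2 N.^ (2 N.* m)) ≡ x) where
  open FieldArith F
  open Char2 F char2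

  q : ℕ
  q = 2 N.^ m

  c : Carrier → Carrier
  c z = z ^ q

  q*q : q N.* q ≡ 2 N.^ (2 N.* m)
  q*q = trans (cong (λ k → q N.* 2 N.^ k) (sym (NP.+-identityʳ m))) (sym (NP.^-distribˡ-+-* 2 m (m N.+ 0)))

  c-involutive : ∀ z → c (c z) ≡ z
  c-involutive z = trans (sym (^-* z q q)) (trans (cong (z ^_) q*q) (fermat z))

  c-+ : ∀ x y → c (x + y) ≡ c x + c y
  c-+ = frob m

  c-* : ∀ x y → c (x * y) ≡ c x * c y
  c-* x y = *-^ x y q

  c-^ : ∀ x k → c (x ^ k) ≡ (c x) ^ k
  c-^ x k = ^-comm x k q

  c-1 : c 1# ≡ 1#
  c-1 = 1^ q

  fixed-* : ∀ {x y} → c x ≡ x → c y ≡ y → c (x * y) ≡ x * y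
  fixed-* cx cy = trans (c-* _ _) (cong₂ _*_ cx cy)

  fixed-^ : ∀ {x} k → c x ≡ x → c (x ^ k) ≡ x ^ k
  fixed-^ k cx = trans (c-^ _ k) (cong (_^ k) cx)

  fixed-inverse : ∀ {x y} → c x ≡ x → x * y ≡ 1# → c y ≡ y
  fixed-inverse {x} {y} cx xy = cancel x≢0 (begin
      x * c y      ≡⟨ cong (_* c y) (sym cx) ⟩
      c x * c y    ≡⟨ sym (c-* x y) ⟩
      c (x * y)    ≡⟨ cong c xy ⟩
      c 1#         ≡⟨ c-1 ⟩
      1#           ≡⟨ sym xy ⟩
      x * y        ∎)
    where
    open ≡-Reasoning
    x≢0 : x ≢ 0#
    x≢0 x≡0 = 1≢0 (trans (sym xy) (trans (cong (_* y) x≡0) (zeroˡ y)))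

  Tr-2m : ∀ z → Tr (2 N.* m) z ≡ Tr m z + Tr m (c z)
  Tr-2m z = trans (Tr-split m (m N.+ 0) z) (cong (λ k → Tr m z + Tr k (c z)) (NP.+-identityʳ m))

  Tr-sq-fixed : ∀ z → c z ≡ z → Tr m (z ^ 2) ≡ Tr m z
  Tr-sq-fixed z cz = sym (+-cancelʳ z (begin
      Tr m z + z                     ≡⟨ cong (Tr m z +_) (sym cz) ⟩
      Tr (1 N.+ m) z                 ≡⟨ Tr-split 1 m z ⟩
      (0# + z * 1#) + Tr m (z ^ 2)   ≡⟨ cong (_+ Tr m (z ^ 2)) (trans (+-identityˡ _) (*-identityʳ z)) ⟩
      z + Tr m (z ^ 2)               ≡⟨ +-comm z _ ⟩
      Tr m (z ^ 2) + z               ∎))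
    where open ≡-Reasoning

  Tr-frob-fixed : ∀ l z → c z ≡ z → Tr m (z ^ (2 N.^ l)) ≡ Tr m z
  Tr-frob-fixed zero z cz = cong (Tr m) (*-identityʳ z)
  Tr-frob-fixed (suc l) z cz = begin
      Tr m (z ^ (2 N.* 2 N.^ l))     ≡⟨ cong (Tr m) (^-* z 2 (2 N.^ l)) ⟩
      Tr m ((z ^ 2) ^ (2 N.^ l))     ≡⟨ Tr-frob-fixed l (z ^ 2) (fixed-^ 2 cz) ⟩
      Tr m (z ^ 2)                   ≡⟨ Tr-sq-fixed z cz ⟩
      Tr m z                         ∎
    where open ≡-Reasoning

  -- Tr_m maps the subfield to F_2, since its value is idempotent
  Tr-fixed-F2 : ∀ z → c z ≡ z → InF2 (Tr m z)
  Tr-fixed-F2 z cz = idempotent (Tr m z) (trans (Tr-sq m z) (Tr-sq-fixed z cz))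

  Tr-relative : ∀ θ z → θ + c θ ≡ 1# → c z ≡ z → Tr (2 N.* m) (θ * z) ≡ Tr m z
  Tr-relative θ z θ+θ̄ cz = begin
      Tr (2 N.* m) (θ * z)               ≡⟨ Tr-2m (θ * z) ⟩
      Tr m (θ * z) + Tr m (c (θ * z))    ≡⟨ sym (Tr-+ m _ _) ⟩
      Tr m (θ * z + c (θ * z))           ≡⟨ cong (λ w → Tr m (θ * z + w)) (trans (c-* θ z) (cong (c θ *_) cz)) ⟩
      Tr m (θ * z + c θ * z)             ≡⟨ cong (Tr m) (sym (distribʳ z θ (c θ))) ⟩
      Tr m ((θ + c θ) * z)               ≡⟨ cong (λ w → Tr m (w * z)) θ+θ̄ ⟩
      Tr m (1# * z)                      ≡⟨ cong (Tr m) (*-identityˡ z) ⟩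
      Tr m z                             ∎
    where open ≡-Reasoning

  -- for w_i = z̄, w_(K-i) = z the pair contributes Tr_m(z̄) + Tr_m(z) = Tr_(2m)(z)
  Tr-pair : ∀ (w : ℕ → Carrier) K i → c (w (K N.∸ i)) ≡ w i → Tr m (w i + w (K N.∸ i)) ≡ Tr (2 N.* m) (w (K N.∸ i))
  Tr-pair w K i sym-i = begin
      Tr m (w i + z)           ≡⟨ Tr-+ m (w i) z ⟩
      Tr m (w i) + Tr m z      ≡⟨ cong (λ y → Tr m y + Tr m z) (sym sym-i) ⟩
      Tr m (c z) + Tr m z      ≡⟨ +-comm _ _ ⟩
      Tr m z + Tr m (c z)      ≡⟨ sym (Tr-2m z) ⟩
      Tr (2 N.* m) z           ∎
    where
    open ≡-Reasoning
    z = w (K N.∸ i)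

  Tr-fold : ∀ (w : ℕ → Carrier) H K → K ≡ H N.+ H → 1 N.≤ H → (∀ i → i N.≤ K → c (w (K N.∸ i)) ≡ w i) →
            Tr m (Σ< w (suc K)) ≡ (Tr m (w H) + Σ< (λ i → Tr (2 N.* m) (w (K N.∸ suc i))) (H N.∸ 1)) + Tr m (w 0 + w K)
  Tr-fold w (suc H') _ refl _ symmetric = begin
      Tr m (Σ< w (suc K))
        ≡⟨ cong (Tr m) (Σ<-fold w H) ⟩
      Tr m (w H + Σ< pair H)
        ≡⟨ cong (λ s → Tr m (w H + s)) (Σ<-front pair H') ⟩
      Tr m (w H + (pair 0 + Σ< (λ i → pair (suc i)) H'))
        ≡⟨ trans (Tr-+ m _ _) (cong (Tr m (w H) +_) (trans (Tr-+ m _ _) (cong (Tr m (pair 0) +_) (Tr-Σ< m _ H')))) ⟩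
      Tr m (w H) + (Tr m (pair 0) + Σ< (λ i → Tr m (pair (suc i))) H')
        ≡⟨ cong (λ s → Tr m (w H) + (Tr m (pair 0) + s)) (Σ<-cong H' (λ i i< → Tr-pair w K (suc i) (symmetric (suc i) (bound i i<)))) ⟩
      Tr m (w H) + (Tr m (pair 0) + Σ< (λ i → Tr (2 N.* m) (w (K N.∸ suc i))) H')
        ≡⟨ solve 3 (λ x y z → x :+ (y :+ z) := (x :+ z) :+ y) refl _ _ _ ⟩
      (Tr m (w H) + Σ< (λ i → Tr (2 N.* m) (w (K N.∸ suc i))) H') + Tr m (w 0 + w K) ∎
    where
    open ≡-Reasoning
    H = suc H'
    K = H N.+ H
    pair : ℕ → Carrier
    pair i = w i + w (K N.∸ i)
    bound : ∀ i → i N.< H' → suc i N.≤ K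
    bound i i< = NP.≤-trans i< (NP.≤-trans (NP.n≤1+n H') (NP.m≤m+n H H))

-- Writing D and the exponent k of t in binary, the product is
-- ∏_i Z_(D_i)^(2^i) with Z_0 = X, Z_1 = Y, so the coefficient of t^k t̄^(2^j-1-k)
-- is γ_j D k = ∏_i sel(D_i, k_i)^(2^i).  It is a monomial a^u ā^v with u + v = D,
-- and conjugation maps it to the coefficient of the complementary monomial.
module Expansion (m : ℕ) (F : GF2^ (2 N.* m))
    (char2 : GF2^._+_ F (GF2^.1# F) (GF2^.1# F) ≡ GF2^.0# F)
    (fermat : ∀ x → GF2^._^_ F x (2 N.^ (2 N.* m)) ≡ x)
    (a : GF2^.Carrier F) where
  open FieldArith F
  open Char2 F char2
  open Conjugation m F char2 fermat
  open Digits

  -- the coefficient of t in X (b = false) or Y (b = true)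
  β : Bool → Carrier
  β false = 1#
  β true = a

  -- Z b t = β t + β̄ t̄; sel b p is its coefficient of t (p = true) or of t̄ (p = false)
  Z : Bool → Carrier → Carrier
  Z b t = β b * t + c (β b) * c t

  sel : Bool → Bool → Carrier
  sel b true = β b
  sel b false = c (β b)

  mon : Carrier → ℕ → ℕ → Carrier
  mon t i e = t ^ i * c t ^ e

  X-form : ∀ t → Z false t ≡ t + c t
  X-form t = cong₂ _+_ (*-identityˡ t) (trans (cong (_* c t) c-1) (*-identityˡ (c t)))

  P : ℕ → ℕ → Carrier → Carrier
  P j D t = Z false t ^ compl j D * Z true t ^ D

  γ : ℕ → ℕ → ℕ → Carrier
  γ zero D k = 1#
  γ (suc j) D k = sel (bit D) (bit k) * (γ j (half D) (half k)) ^ 2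

  ^-digits : ∀ x b h → x ^ (⟦ b ⟧ N.+ (h N.+ h)) ≡ x ^ ⟦ b ⟧ * (x ^ h) ^ 2
  ^-digits x b h = trans (^-+ x ⟦ b ⟧ (h N.+ h)) (cong (x ^ ⟦ b ⟧ *_) (trans (^-+ x h h) (sym (sq (x ^ h)))))

  Z-digit : ∀ b t → Z false t ^ ⟦ not b ⟧ * Z true t ^ ⟦ b ⟧ ≡ Z b t
  Z-digit false t = trans (*-identityʳ _) (*-identityʳ _)
  Z-digit true t = trans (*-identityˡ _) (*-identityʳ _)

  P-step : ∀ j D t → D N.< 2 N.^ suc j → P (suc j) D t ≡ Z (bit D) t * (P j (half D) t) ^ 2
  P-step j D t D< = by-digits (λ D → P (suc j) D t ≡ Z (bit D) t * (P j (half D) t) ^ 2) j D D< step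
    where
    X = Z false t
    Y = Z true t
    step : ∀ b h → h N.< 2 N.^ j → P (suc j) (⟦ b ⟧ N.+ (h N.+ h)) t ≡ Z (bit (⟦ b ⟧ N.+ (h N.+ h))) t * (P j (half (⟦ b ⟧ N.+ (h N.+ h))) t) ^ 2
    step b h h< rewrite bit-digits b h | half-digits b h = begin
        X ^ compl (suc j) (⟦ b ⟧ N.+ (h N.+ h)) * Y ^ (⟦ b ⟧ N.+ (h N.+ h))
          ≡⟨ cong (λ e → X ^ e * Y ^ (⟦ b ⟧ N.+ (h N.+ h))) (compl-digits j b h h<) ⟩
        X ^ (⟦ not b ⟧ N.+ (e N.+ e)) * Y ^ (⟦ b ⟧ N.+ (h N.+ h))
          ≡⟨ cong₂ _*_ (^-digits X (not b) e) (^-digits Y b h) ⟩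
        (X ^ ⟦ not b ⟧ * (X ^ e) ^ 2) * (Y ^ ⟦ b ⟧ * (Y ^ h) ^ 2)
          ≡⟨ solve 4 (λ x A y B → (x :* A) :* (y :* B) := (x :* y) :* (A :* B)) refl _ _ _ _ ⟩
        (X ^ ⟦ not b ⟧ * Y ^ ⟦ b ⟧) * ((X ^ e) ^ 2 * (Y ^ h) ^ 2)
          ≡⟨ cong₂ _*_ (Z-digit b t) (sym (*-^ (X ^ e) (Y ^ h) 2)) ⟩
        Z b t * (X ^ e * Y ^ h) ^ 2 ∎
      where
      open ≡-Reasoning
      e = compl j h

  γ-step : ∀ j D p k → γ (suc j) D (⟦ p ⟧ N.+ (k N.+ k)) ≡ sel (bit D) p * (γ j (half D) k) ^ 2
  γ-step j D p k rewrite bit-digits p k | half-digits p k = refl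

  mon-sq : ∀ t g k e → (g * mon t k e) ^ 2 ≡ g ^ 2 * mon t (k N.+ k) (e N.+ e)
  mon-sq t g k e rewrite ^-+ t k k | ^-+ (c t) e e | sq (g * mon t k e) | sq g =
    solve 3 (λ g T S → (g :* (T :* S)) :* (g :* (T :* S)) := (g :* g) :* ((T :* T) :* (S :* S))) refl g (t ^ k) (c t ^ e)

  expansion : ∀ j D t → D N.< 2 N.^ j → P j D t ≡ Σ< (λ k → γ j D k * mon t k (compl j k)) (2 N.^ j)
  expansion zero (suc D) t (N.s≤s ())
  expansion zero zero t _ = trans (*-identityˡ 1#) (sym (trans (+-identityˡ _) (trans (*-identityˡ _) (*-identityˡ _))))
  expansion (suc j) D t D< = begin
      P (suc j) D t                                  ≡⟨ P-step j D t D< ⟩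
      Z b t * (P j (half D) t) ^ 2                   ≡⟨ cong (λ w → Z b t * w ^ 2) (expansion j (half D) t (half-below j D D<)) ⟩
      Z b t * (Σ< f (2 N.^ j)) ^ 2                   ≡⟨ cong (Z b t *_) (Σ<-frob 1 f (2 N.^ j)) ⟩
      Z b t * Σ< (λ k → f k ^ 2) (2 N.^ j)           ≡⟨ Σ<-*ˡ _ _ (2 N.^ j) ⟩
      Σ< (λ k → Z b t * f k ^ 2) (2 N.^ j)           ≡⟨ Σ<-cong (2 N.^ j) split ⟩
      Σ< (λ k → g (k N.+ k) + g (suc (k N.+ k))) (2 N.^ j)
                                                     ≡⟨ sym (Σ<-pairs g (2 N.^ j)) ⟩
      Σ< g (2 N.^ j N.+ 2 N.^ j)                     ≡⟨ cong (λ K → Σ< g (2 N.^ j N.+ K)) (sym (NP.+-identityʳ _)) ⟩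
      Σ< g (2 N.^ suc j)                             ∎
    where
    open ≡-Reasoning
    b = bit D
    f : ℕ → Carrier
    f k = γ j (half D) k * mon t k (compl j k)
    g : ℕ → Carrier
    g k = γ (suc j) D k * mon t k (compl (suc j) k)
    split : ∀ k → k N.< 2 N.^ j → Z b t * f k ^ 2 ≡ g (k N.+ k) + g (suc (k N.+ k))
    split k k< rewrite mon-sq t (γ j (half D) k) k (compl j k)
                     | compl-digits j false k k< | compl-digits j true k k<
                     | γ-step j D false k | γ-step j D true k =
      solve 7 (λ A B x s G T S → (A :* x :+ B :* s) :* (G :* (T :* S)) := (B :* G) :* (T :* (s :* S)) :+ (A :* G) :* ((x :* T) :* S)) refl
        (sel b true) (sel b false) t (c t) (γ j (half D) k ^ 2) (t ^ (k N.+ k)) (c t ^ (compl j k N.+ compl j k))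

  c-sel : ∀ b p → c (sel b p) ≡ sel b (not p)
  c-sel b true = refl
  c-sel b false = c-involutive (β b)

  γ-conj : ∀ j D k → k N.< 2 N.^ j → c (γ j D k) ≡ γ j D (compl j k)
  γ-conj zero D k _ = c-1
  γ-conj (suc j) D k k< = by-digits (λ k → c (γ (suc j) D k) ≡ γ (suc j) D (compl (suc j) k)) j k k< step
    where
    step : ∀ p h → h N.< 2 N.^ j → c (γ (suc j) D (⟦ p ⟧ N.+ (h N.+ h))) ≡ γ (suc j) D (compl (suc j) (⟦ p ⟧ N.+ (h N.+ h)))
    step p h h< = begin
        c (γ (suc j) D (⟦ p ⟧ N.+ (h N.+ h)))                   ≡⟨ cong c (γ-step j D p h) ⟩
        c (sel (bit D) p * γ j (half D) h ^ 2)                  ≡⟨ c-* _ _ ⟩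
        c (sel (bit D) p) * c (γ j (half D) h ^ 2)
          ≡⟨ cong₂ _*_ (c-sel (bit D) p) (trans (c-^ _ 2) (cong (_^ 2) (γ-conj j (half D) h h<))) ⟩
        sel (bit D) (not p) * γ j (half D) (compl j h) ^ 2      ≡⟨ sym (γ-step j D (not p) (compl j h)) ⟩
        γ (suc j) D (⟦ not p ⟧ N.+ (compl j h N.+ compl j h))   ≡⟨ cong (γ (suc j) D) (sym (compl-digits j p h h<)) ⟩
        γ (suc j) D (compl (suc j) (⟦ p ⟧ N.+ (h N.+ h)))       ∎
      where open ≡-Reasoning

  -- γ_j D k = a^u ā^v, where u (resp. v) collects the digits of D at the
  -- positions where k has a one (resp. a zero)
  uExp : ℕ → ℕ → ℕ → ℕ
  uExp zero D k = 0
  uExp (suc j) D k = ⟦ bit D ∧ bit k ⟧ N.+ (uExp j (half D) (half k) N.+ uExp j (half D) (half k))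

  vExp : ℕ → ℕ → ℕ → ℕ
  vExp zero D k = 0
  vExp (suc j) D k = ⟦ bit D ∧ not (bit k) ⟧ N.+ (vExp j (half D) (half k) N.+ vExp j (half D) (half k))

  sel-power : ∀ b p → sel b p ≡ a ^ ⟦ b ∧ p ⟧ * c a ^ ⟦ b ∧ not p ⟧
  sel-power false true = sym (*-identityˡ 1#)
  sel-power false false = trans c-1 (sym (*-identityˡ 1#))
  sel-power true true = sym (trans (*-identityʳ _) (*-identityʳ a))
  sel-power true false = sym (trans (*-identityˡ _) (*-identityʳ (c a)))

  γ-power : ∀ j D k → γ j D k ≡ a ^ uExp j D k * c a ^ vExp j D k
  γ-power zero D k = sym (*-identityˡ 1#)
  γ-power (suc j) D k = begin
      sel b p * γ j (half D) (half k) ^ 2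
        ≡⟨ cong₂ (λ s g → s * g ^ 2) (sel-power b p) (γ-power j (half D) (half k)) ⟩
      (a ^ ⟦ b ∧ p ⟧ * c a ^ ⟦ b ∧ not p ⟧) * (a ^ u * c a ^ v) ^ 2
        ≡⟨ cong ((a ^ ⟦ b ∧ p ⟧ * c a ^ ⟦ b ∧ not p ⟧) *_) (*-^ (a ^ u) (c a ^ v) 2) ⟩
      (a ^ ⟦ b ∧ p ⟧ * c a ^ ⟦ b ∧ not p ⟧) * ((a ^ u) ^ 2 * (c a ^ v) ^ 2)
        ≡⟨ solve 4 (λ S T A B → (S :* T) :* (A :* B) := (S :* A) :* (T :* B)) refl _ _ _ _ ⟩
      (a ^ ⟦ b ∧ p ⟧ * (a ^ u) ^ 2) * (c a ^ ⟦ b ∧ not p ⟧ * (c a ^ v) ^ 2)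
        ≡⟨ sym (cong₂ _*_ (^-digits a (b ∧ p) u) (^-digits (c a) (b ∧ not p) v)) ⟩
      a ^ uExp (suc j) D k * c a ^ vExp (suc j) D k ∎
    where
    open ≡-Reasoning
    b = bit D
    p = bit k
    u = uExp j (half D) (half k)
    v = vExp j (half D) (half k)

  uv-sum : ∀ j D k → D N.< 2 N.^ j → uExp j D k N.+ vExp j D k ≡ D
  uv-sum zero zero k _ = refl
  uv-sum zero (suc D) k (N.s≤s ())
  uv-sum (suc j) D k D< = trans (digit-split (bit D) (bit k) (uExp j (half D) (half k)) (vExp j (half D) (half k)))
    (trans (cong (λ s → ⟦ bit D ⟧ N.+ (s N.+ s)) (uv-sum j (half D) (half k) (half-below j D D<))) (bit-half D))

square-pred : ∀ p → suc p N.* suc p N.∸ 1 ≡ p N.* (suc p N.+ 1)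
square-pred = solve 1 (λ p → p :+ p :* (con 1 :+ p) := p :* ((con 1 :+ p) :+ con 1)) refl
  where open +-*-Solver using (solve; _:+_; _:*_; _:=_; con)

-- Here
-- the monomials a^u ā^v with u + v < q are pairwise distinct, because a^δ lies
-- outside the subfield for 0 < δ < q (the order (q-1)(q+1) of a is too large).
module Setting (m : ℕ) (m≥1 : 1 N.≤ m) (F : GF2^ (2 N.* m)) (a : GF2^.Carrier F) (prim : GF2^.Primitive F a) where
  open FieldArith F public
  open PrimitiveElement F (NP.≤-trans m≥1 (NP.m≤m+n m (m N.+ 0))) a prim public
  open Char2 F char2 public
  open Conjugation m F char2 fermat public
  open Expansion m F char2 fermat a public
  open Digits

  q-1 : ℕ
  q-1 = q N.∸ 1

  q-1≥1 : 1 N.≤ q-1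
  q-1≥1 = NP.≤-pred (subst (2 N.≤_) (pow2-suc m) (NP.^-monoʳ-≤ 2 m≥1))

  instance
    q-1-nonZero : NonZero q-1
    q-1-nonZero = ≢-nonZero (λ e → NP.<⇒≢ q-1≥1 (sym e))

  ord-factors : ord ≡ q-1 N.* (q N.+ 1)
  ord-factors = trans (cong (N._∸ 1) (sym q*q)) (trans (cong (λ z → z N.* z N.∸ 1) (pow2-suc m))
    (trans (square-pred q-1) (cong (λ z → q-1 N.* (z N.+ 1)) (sym (pow2-suc m)))))

  small-power-not-fixed : ∀ δ → 1 N.≤ δ → δ N.< q → c (a ^ δ) ≢ a ^ δ
  small-power-not-fixed δ δ≥1 δ<q fixed = NP.<-asym δ<q q<δ
    where
    a^[q-1]δ : a ^ (q-1 N.* δ) ≡ 1#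
    a^[q-1]δ = sym (cancel (nz-^ δ a≢0) (begin
        a ^ δ * 1#                  ≡⟨ *-identityʳ _ ⟩
        a ^ δ                       ≡⟨ sym fixed ⟩
        (a ^ δ) ^ q                 ≡⟨ sym (^-* a δ q) ⟩
        a ^ (δ N.* q)               ≡⟨ cong (λ z → a ^ (δ N.* z)) (pow2-suc m) ⟩
        a ^ (δ N.* suc q-1)         ≡⟨ cong (a ^_) (trans (NP.*-suc δ q-1) (cong (δ N.+_) (NP.*-comm δ q-1))) ⟩
        a ^ (δ N.+ q-1 N.* δ)       ≡⟨ ^-+ a δ (q-1 N.* δ) ⟩
        a ^ δ * a ^ (q-1 N.* δ)     ∎))
      where open ≡-Reasoning
    q+1∣δ : (q N.+ 1) ∣ δ
    q+1∣δ = *-cancelˡ-∣ q-1 (subst (_∣ q-1 N.* δ) ord-factors (order-divides _ a^[q-1]δ))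
    q<δ : q N.< δ
    q<δ = subst (N._≤ δ) (NP.+-comm q 1) (∣⇒≤ ⦃ ≢-nonZero (λ e → NP.<⇒≢ δ≥1 (sym e)) ⦄ q+1∣δ)

  ā≢0 : c a ≢ 0#
  ā≢0 = nz-^ q a≢0

  shifted-distinct : ∀ u v δ → 1 N.≤ δ → δ N.< q → a ^ u * c a ^ (v N.+ δ) ≢ a ^ (u N.+ δ) * c a ^ v
  shifted-distinct u v δ δ≥1 δ<q e =
    small-power-not-fixed δ δ≥1 δ<q (trans (c-^ a δ) (cancel (nz-* (nz-^ u a≢0) (nz-^ v ā≢0)) (begin
      (a ^ u * c a ^ v) * c a ^ δ    ≡⟨ *-assoc _ _ _ ⟩
      a ^ u * (c a ^ v * c a ^ δ)    ≡⟨ cong (a ^ u *_) (sym (^-+ (c a) v δ)) ⟩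
      a ^ u * c a ^ (v N.+ δ)        ≡⟨ e ⟩
      a ^ (u N.+ δ) * c a ^ v        ≡⟨ cong (_* c a ^ v) (^-+ a u δ) ⟩
      (a ^ u * a ^ δ) * c a ^ v      ≡⟨ solve 3 (λ x y z → (x :* y) :* z := (x :* z) :* y) refl _ _ _ ⟩
      (a ^ u * c a ^ v) * a ^ δ      ∎)))
    where open ≡-Reasoning

  ordered-distinct : ∀ u₁ v₁ u₂ v₂ → u₁ N.< u₂ → u₁ N.+ v₁ ≡ u₂ N.+ v₂ → u₁ N.+ v₁ N.< q →
                     a ^ u₁ * c a ^ v₁ ≢ a ^ u₂ * c a ^ v₂
  ordered-distinct u₁ v₁ u₂ v₂ u₁<u₂ same small =
    subst₂ (λ U V → a ^ u₁ * c a ^ V ≢ a ^ U * c a ^ v₂) (sym u₂≡) (sym v₁≡)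
      (shifted-distinct u₁ v₂ δ (NP.m<n⇒0<n∸m u₁<u₂) δ<q)
    where
    δ = u₂ N.∸ u₁
    u₂≡ : u₂ ≡ u₁ N.+ δ
    u₂≡ = sym (NP.m+[n∸m]≡n (NP.<⇒≤ u₁<u₂))
    v₁≡ : v₁ ≡ v₂ N.+ δ
    v₁≡ = NP.+-cancelˡ-≡ u₁ v₁ (v₂ N.+ δ)
      (trans same (trans (cong (N._+ v₂) u₂≡) (trans (NP.+-assoc u₁ δ v₂) (cong (u₁ N.+_) (NP.+-comm δ v₂)))))
    δ<q : δ N.< q
    δ<q = NP.≤-<-trans (NP.≤-trans (NP.m≤n+m δ v₂) (NP.≤-trans (NP.≤-reflexive (sym v₁≡)) (NP.m≤n+m v₁ u₁))) small

  monomials-distinct : ∀ u₁ v₁ u₂ v₂ → u₁ N.+ v₁ ≡ u₂ N.+ v₂ → u₁ N.+ v₁ N.< q → u₁ ≢ u₂ →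
                       a ^ u₁ * c a ^ v₁ ≢ a ^ u₂ * c a ^ v₂
  monomials-distinct u₁ v₁ u₂ v₂ same small u₁≢u₂ with NP.<-cmp u₁ u₂
  ... | tri≈ _ u₁≡u₂ _ = ⊥-elim (u₁≢u₂ u₁≡u₂)
  ... | tri< u₁<u₂ _ _ = ordered-distinct u₁ v₁ u₂ v₂ u₁<u₂ same small
  ... | tri> _ _ u₂<u₁ = λ e → ordered-distinct u₂ v₂ u₁ v₁ u₂<u₁ (sym same) (subst (N._< q) same small) (sym e)

  -- for odd D, neighbouring coefficients γ_k, γ_(k+1) of X^(2^j-1-D) Y^D differ:
  -- their exponents of a have different parities
  γ-adjacent : ∀ j D k → bit D ≡ true → D N.< 2 N.^ suc j → 2 N.^ suc j N.≤ q →
               γ (suc j) D k ≢ γ (suc j) D (suc k)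
  γ-adjacent j D k D-odd D< K≤q e = monomials-distinct _ _ _ _
    (trans (uv-sum (suc j) D k D<) (sym (uv-sum (suc j) D (suc k) D<)))
    (subst (N._< q) (sym (uv-sum (suc j) D k D<)) (NP.<-≤-trans D< K≤q))
    parities-differ
    (trans (sym (γ-power (suc j) D k)) (trans e (γ-power (suc j) D (suc k))))
    where
    u-parity : ∀ k → bit (uExp (suc j) D k) ≡ bit k
    u-parity k = trans (bit-digits (bit D ∧ bit k) (uExp j (half D) (half k))) (cong (_∧ bit k) D-odd)
    parities-differ : uExp (suc j) D k ≢ uExp (suc j) D (suc k)
    parities-differ ue = not-fixed (bit k) (trans (sym (u-parity k)) (trans (cong bit ue) (trans (u-parity (suc k)) (bit-suc k))))
      where
      not-fixed : ∀ b → b ≢ not b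
      not-fixed false ()
      not-fixed true ()

  -- an element θ ≠ 0 with θ + θ̄ = 1, namely θ = a/(a + ā)
  trace-dual : ∃ λ θ → θ ≢ 0# × θ + c θ ≡ 1#
  trace-dual = a * s , nz-* a≢0 s≢0 , θ+θ̄
    where
    a+ā≢0 : a + c a ≢ 0#
    a+ā≢0 e = small-power-not-fixed 1 NP.≤-refl (NP.<-≤-trans (NP.n<1+n 1) (NP.^-monoʳ-≤ 2 m≥1))
      (trans (c-^ a 1) (cong (_* 1#) (sym (sum≡0 e))))
    s = proj₁ (inverse (a + c a) a+ā≢0)
    [a+ā]s : (a + c a) * s ≡ 1#
    [a+ā]s = proj₂ (inverse (a + c a) a+ā≢0)
    s≢0 : s ≢ 0#
    s≢0 s≡0 = 1≢0 (trans (sym [a+ā]s) (trans (cong ((a + c a) *_) s≡0) (zeroʳ _)))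
    a+ā-fixed : c (a + c a) ≡ a + c a
    a+ā-fixed = trans (c-+ a (c a)) (trans (cong (c a +_) (c-involutive a)) (+-comm _ _))
    θ+θ̄ : a * s + c (a * s) ≡ 1#
    θ+θ̄ = begin
        a * s + c (a * s)        ≡⟨ cong (a * s +_) (trans (c-* a s) (cong (c a *_) (fixed-inverse a+ā-fixed [a+ā]s))) ⟩
        a * s + c a * s          ≡⟨ sym (distribʳ s a (c a)) ⟩
        (a + c a) * s            ≡⟨ [a+ā]s ⟩
        1#                       ∎
      where open ≡-Reasoning

-- (q-1)(p·i + 1) + 1 = ((K - i) + q·i)·p when p·K = q; this is the exponent
-- of t in the coefficient A_i of the theorem
exponent-identity : ∀ p i k w → p N.* (i N.+ k) ≡ suc w → w N.* (p N.* i N.+ 1) N.+ 1 ≡ (k N.+ suc w N.* i) N.* p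
exponent-identity p i k w pK≡q = begin
    w N.* (p N.* i N.+ 1) N.+ 1              ≡⟨ solve 4 (λ p i k w → w :* (p :* i :+ con 1) :+ con 1 := (w :* i) :* p :+ (con 1 :+ w)) refl p i k w ⟩
    (w N.* i) N.* p N.+ suc w                ≡⟨ cong ((w N.* i) N.* p N.+_) (sym pK≡q) ⟩
    (w N.* i) N.* p N.+ p N.* (i N.+ k)      ≡⟨ solve 4 (λ p i k w → (w :* i) :* p :+ p :* (i :+ k) := (k :+ (con 1 :+ w) :* i) :* p) refl p i k w ⟩
    (k N.+ suc w N.* i) N.* p                ∎
  where
  open ≡-Reasoning
  open +-*-Solver using (solve; _:+_; _:*_; _:=_; con)

module Assembly (m : ℕ) (m≥1 : 1 N.≤ m) (F : GF2^ (2 N.* m)) (a : GF2^.Carrier F) (prim : GF2^.Primitive F a)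
    (l r₀ D : ℕ) (m≡ : m ≡ l N.+ suc r₀) (D-odd : Digits.bit D ≡ true) (D< : D N.< 2 N.^ suc r₀)
    (lam : GF2^.Carrier F) (lam-fixed : GF2^.InSub F m lam) (lam≢0 : lam ≢ GF2^.0# F) where
  open Setting m m≥1 F a prim
  open Digits

  r K H p : ℕ
  r = suc r₀
  K = 2 N.^ r
  H = 2 N.^ r₀
  p = 2 N.^ l

  K≡H+H : K ≡ H N.+ H
  K≡H+H = cong (H N.+_) (NP.+-identityʳ H)

  K≥1 : 1 N.≤ K
  K≥1 = NP.m^n>0 2 r

  H≥1 : 1 N.≤ H
  H≥1 = NP.m^n>0 2 r₀

  q≡p*K : q ≡ p N.* K
  q≡p*K = trans (cong (2 N.^_) m≡) (NP.^-distribˡ-+-* 2 l r)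

  K≤q : K N.≤ q
  K≤q = subst (λ z → K N.≤ 2 N.^ z) (sym m≡) (NP.^-monoʳ-≤ 2 (NP.m≤n+m r l))

  γ< : ℕ → Carrier
  γ< = truncate K (γ r D)

  γ<-below : ∀ k → k N.< K → γ< k ≡ γ r D k
  γ<-below = truncate-below K (γ r D)

  γ<-K : γ< K ≡ 0#
  γ<-K = truncate-at K (γ r D)

  -- the coefficient of t^i t̄^(K-i) in X·P
  cf : ℕ → Carrier
  cf = Δ γ<

  M : Carrier → ℕ → Carrier
  M t i = mon t i (K N.∸ i)

  XP-expansion : ∀ t → Z false t * P r D t ≡ Σ< (λ i → cf i * M t i) (suc K)
  XP-expansion t = begin
      Z false t * P r D t                                   ≡⟨ cong (Z false t *_) (expansion r D t D<) ⟩
      Z false t * Σ< (λ k → γ r D k * mon t k (compl r k)) K ≡⟨ Σ<-*ˡ _ _ K ⟩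
      Σ< (λ k → Z false t * (γ r D k * mon t k (compl r k))) K ≡⟨ Σ<-cong K raise ⟩
      Σ< (λ k → γ< k * (M t (suc k) + M t k)) K              ≡⟨ sym (+-identityʳ _) ⟩
      Σ< (λ k → γ< k * (M t (suc k) + M t k)) K + 0#         ≡⟨ cong (Σ< (λ k → γ< k * (M t (suc k) + M t k)) K +_) (sym (trans (cong (_* M t K) γ<-K) (zeroˡ _))) ⟩
      Σ< (λ k → γ< k * (M t (suc k) + M t k)) K + γ< K * M t K ≡⟨ Σ<-by-parts γ< (M t) K ⟩
      Σ< (λ i → cf i * M t i) (suc K)                        ∎
    where
    open ≡-Reasoning
    raise : ∀ k → k N.< K → Z false t * (γ r D k * mon t k (compl r k)) ≡ γ< k * (M t (suc k) + M t k)
    raise k k< = begin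
        Z false t * (γ r D k * mon t k e)
          ≡⟨ cong (_* (γ r D k * mon t k e)) (X-form t) ⟩
        (t + c t) * (γ r D k * mon t k e)
          ≡⟨ solve 5 (λ x s g T S → (x :+ s) :* (g :* (T :* S)) := g :* ((x :* T) :* S :+ T :* (s :* S))) refl t (c t) (γ r D k) (t ^ k) (c t ^ e) ⟩
        γ r D k * (mon t (suc k) e + mon t k (suc e))
          ≡⟨ cong₂ (λ g z → g * z) (sym (γ<-below k k<))
                   (cong₂ _+_ (cong (mon t (suc k)) (NP.∸-+-assoc K 1 k)) (cong (mon t k) (sym (compl-sub r k k<)))) ⟩
        γ< k * (M t (suc k) + M t k) ∎
      where e = compl r k

  -- the summands of λ (X·P)^(2^l)
  W : Carrier → ℕ → Carrier
  W t i = lam * (cf i * M t i) ^ p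

  lhs-as-sum : ∀ t → lam * Z false t ^ (q N.∸ D N.* p) * Z true t ^ (D N.* p) ≡ Σ< (W t) (suc K)
  lhs-as-sum t = begin
      lam * X ^ (q N.∸ D N.* p) * Y ^ (D N.* p)    ≡⟨ *-assoc _ _ _ ⟩
      lam * (X ^ (q N.∸ D N.* p) * Y ^ (D N.* p))  ≡⟨ cong (λ z → lam * (X ^ z * Y ^ (D N.* p))) q-d ⟩
      lam * (X ^ (suc e N.* p) * Y ^ (D N.* p))    ≡⟨ cong (lam *_) (cong₂ _*_ (^-* X (suc e) p) (^-* Y D p)) ⟩
      lam * ((X ^ suc e) ^ p * (Y ^ D) ^ p)        ≡⟨ cong (lam *_) (sym (*-^ (X ^ suc e) (Y ^ D) p)) ⟩
      lam * (X * X ^ e * Y ^ D) ^ p                ≡⟨ cong (λ z → lam * z ^ p) (*-assoc _ _ _) ⟩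
      lam * (X * P r D t) ^ p                      ≡⟨ cong (λ z → lam * z ^ p) (XP-expansion t) ⟩
      lam * (Σ< (λ i → cf i * M t i) (suc K)) ^ p  ≡⟨ cong (lam *_) (Σ<-frob l _ (suc K)) ⟩
      lam * Σ< (λ i → (cf i * M t i) ^ p) (suc K)  ≡⟨ Σ<-*ˡ lam _ (suc K) ⟩
      Σ< (W t) (suc K)                             ∎
    where
    open ≡-Reasoning
    X = Z false t
    Y = Z true t
    e = compl r D
    q-d : q N.∸ D N.* p ≡ suc e N.* p
    q-d = begin
        q N.∸ D N.* p          ≡⟨ cong (N._∸ D N.* p) (trans q≡p*K (NP.*-comm p K)) ⟩
        K N.* p N.∸ D N.* p    ≡⟨ sym (NP.*-distribʳ-∸ p K D) ⟩
        (K N.∸ D) N.* p        ≡⟨ cong (N._* p) (compl-sub r D D<) ⟩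
        suc e N.* p            ∎

  γ<-conj : ∀ k → k N.< K → c (γ< k) ≡ γ< (compl r k)
  γ<-conj k k< = trans (cong c (γ<-below k k<)) (trans (γ-conj r D k k<) (sym (γ<-below _ (compl-bound r k k<))))

  cf-conj-end : c (cf 0) ≡ cf K
  cf-conj-end = begin
      c (γ< 0)                  ≡⟨ γ<-conj 0 K≥1 ⟩
      γ< (K N.∸ 1)              ≡⟨ sym (+-identityʳ _) ⟩
      γ< (K N.∸ 1) + 0#         ≡⟨ cong (γ< (K N.∸ 1) +_) (sym (trans (cong γ< (sym (pow2-suc r))) γ<-K)) ⟩
      cf (suc (K N.∸ 1))        ≡⟨ cong cf (sym (pow2-suc r)) ⟩
      cf K                      ∎
    where open ≡-Reasoning

  cf-conj-interior : ∀ i → suc i N.< K → c (cf (suc i)) ≡ cf (K N.∸ suc i)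
  cf-conj-interior i si<K = begin
      c (γ< i + γ< (suc i))           ≡⟨ c-+ _ _ ⟩
      c (γ< i) + c (γ< (suc i))       ≡⟨ cong₂ _+_ (γ<-conj i (NP.<-trans (NP.n<1+n i) si<K)) (γ<-conj (suc i) si<K) ⟩
      γ< (compl r i) + γ< e           ≡⟨ cong (λ k → γ< k + γ< e) compl-i ⟩
      γ< (suc e) + γ< e               ≡⟨ +-comm _ _ ⟩
      cf (suc e)                      ≡⟨ cong cf (sym (compl-sub r (suc i) si<K)) ⟩
      cf (K N.∸ suc i)                ∎
    where
    open ≡-Reasoning
    e = compl r (suc i)
    compl-i : compl r i ≡ suc e
    compl-i = trans (NP.∸-+-assoc K 1 i) (compl-sub r (suc i) si<K)

  cf-conj-top : ∀ i → suc i ≡ K → c (cf (suc i)) ≡ cf (K N.∸ suc i)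
  cf-conj-top i si≡K = begin
      c (cf (suc i))          ≡⟨ cong (λ j → c (cf j)) si≡K ⟩
      c (cf K)                ≡⟨ cong c (sym cf-conj-end) ⟩
      c (c (cf 0))            ≡⟨ c-involutive _ ⟩
      cf 0                    ≡⟨ cong cf (sym (trans (cong (K N.∸_) si≡K) (NP.n∸n≡0 K))) ⟩
      cf (K N.∸ suc i)        ∎
    where open ≡-Reasoning

  cf-conj : ∀ i → i N.≤ K → c (cf i) ≡ cf (K N.∸ i)
  cf-conj zero _ = cf-conj-end
  cf-conj (suc i) si≤K = [ cf-conj-interior i , cf-conj-top i ] (NP.m≤n⇒m<n∨m≡n si≤K)

  M-conj : ∀ t i → i N.≤ K → c (M t (K N.∸ i)) ≡ M t i
  M-conj t i i≤K = begin
      c (t ^ (K N.∸ i) * c t ^ (K N.∸ (K N.∸ i)))     ≡⟨ c-* _ _ ⟩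
      c (t ^ (K N.∸ i)) * c (c t ^ (K N.∸ (K N.∸ i))) ≡⟨ cong₂ _*_ (c-^ t (K N.∸ i)) (trans (c-^ (c t) (K N.∸ (K N.∸ i))) (cong₂ _^_ (c-involutive t) (NP.m∸[m∸n]≡n i≤K))) ⟩
      c t ^ (K N.∸ i) * t ^ i                         ≡⟨ *-comm _ _ ⟩
      M t i                                            ∎
    where open ≡-Reasoning

  W-conj : ∀ t i → i N.≤ K → c (W t (K N.∸ i)) ≡ W t i
  W-conj t i i≤K = begin
      c (lam * (cf j * M t j) ^ p)          ≡⟨ c-* _ _ ⟩
      c lam * c ((cf j * M t j) ^ p)        ≡⟨ cong₂ _*_ lam-fixed (c-^ _ p) ⟩
      lam * (c (cf j * M t j)) ^ p          ≡⟨ cong (λ z → lam * z ^ p) (c-* _ _) ⟩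
      lam * (c (cf j) * c (M t j)) ^ p
        ≡⟨ cong (λ z → lam * z ^ p) (cong₂ _*_ (trans (cf-conj j (NP.m∸n≤m K i)) (cong cf (NP.m∸[m∸n]≡n i≤K))) (M-conj t i i≤K)) ⟩
      W t i                                 ∎
    where
    open ≡-Reasoning
    j = K N.∸ i

  -- c_i ≠ 0 for 0 < i < K, as neighbouring γ's differ (D is odd)
  cf-nonzero : ∀ i → 1 N.≤ i → i N.< K → cf i ≢ 0#
  cf-nonzero (suc i) _ si<K e = γ-adjacent r₀ D i D-odd D< K≤q (sum≡0 (begin
      γ r D i + γ r D (suc i)     ≡⟨ sym (cong₂ _+_ (γ<-below i (NP.<-trans (NP.n<1+n i) si<K)) (γ<-below (suc i) si<K)) ⟩
      cf (suc i)                  ≡⟨ e ⟩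
      0#                          ∎))
    where open ≡-Reasoning

  L : Carrier → Carrier
  L t = Tr m (W t 0 + W t K)

  W-additive : ∀ i → (∀ x y → M (x + y) i ≡ M x i + M y i) → ∀ x y → W (x + y) i ≡ W x i + W y i
  W-additive i M-add x y = begin
      lam * (cf i * M (x + y) i) ^ p                   ≡⟨ cong (λ z → lam * (cf i * z) ^ p) (M-add x y) ⟩
      lam * (cf i * (M x i + M y i)) ^ p               ≡⟨ cong (λ z → lam * z ^ p) (distribˡ _ _ _) ⟩
      lam * (cf i * M x i + cf i * M y i) ^ p          ≡⟨ cong (lam *_) (frob l _ _) ⟩
      lam * ((cf i * M x i) ^ p + (cf i * M y i) ^ p)  ≡⟨ distribˡ _ _ _ ⟩
      W x i + W y i                                    ∎
    where open ≡-Reasoning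

  M-additive-0 : ∀ x y → M (x + y) 0 ≡ M x 0 + M y 0
  M-additive-0 x y = trans (cong (1# *_) (trans (cong (_^ K) (c-+ x y)) (frob r _ _))) (distribˡ _ _ _)

  M-additive-K : ∀ x y → M (x + y) K ≡ M x K + M y K
  M-additive-K x y rewrite NP.n∸n≡0 K = trans (cong (_* 1#) (frob r x y)) (distribʳ _ _ _)

  L-additive : ∀ x y → L (x + y) ≡ L x + L y
  L-additive x y = trans (cong (Tr m) (trans (cong₂ _+_ (W-additive 0 M-additive-0 x y) (W-additive K M-additive-K x y))
    (solve 4 (λ A B C D → (A :+ B) :+ (C :+ D) := (A :+ C) :+ (B :+ D)) refl _ _ _ _))) (Tr-+ m _ _)

  L-binary : ∀ t → InF2 (L t)
  L-binary t = Tr-fixed-F2 _ (begin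
      c (W t 0 + W t K)          ≡⟨ c-+ _ _ ⟩
      c (W t 0) + c (W t K)      ≡⟨ cong₂ _+_ (subst (λ j → c (W t j) ≡ W t K) (NP.n∸n≡0 K) (W-conj t K NP.≤-refl)) (W-conj t 0 N.z≤n) ⟩
      W t K + W t 0              ≡⟨ +-comm _ _ ⟩
      W t 0 + W t K              ∎)
    where open ≡-Reasoning

  -- the middle term: W_H is fixed by conjugation and W_H^2 = ν·t^(q+1)
  -- with ν = λ^2 c_H^(2^(l+1)) in the subfield
  H≤K : H N.≤ K
  H≤K = subst (H N.≤_) (sym K≡H+H) (NP.m≤m+n H H)

  K∸H≡H : K N.∸ H ≡ H
  K∸H≡H = trans (cong (N._∸ H) K≡H+H) (NP.m+n∸m≡n H H)

  H*2p≡q : H N.* 2 N.^ suc l ≡ q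
  H*2p≡q = trans (sym (NP.^-distribˡ-+-* 2 r₀ (suc l)))
    (cong (2 N.^_) (trans (NP.+-suc r₀ l) (trans (cong suc (NP.+-comm r₀ l)) (trans (sym (NP.+-suc l r₀)) (sym m≡)))))

  W-middle-fixed : ∀ t → c (W t H) ≡ W t H
  W-middle-fixed t = subst (λ j → c (W t j) ≡ W t H) K∸H≡H (W-conj t H H≤K)

  ν : Carrier
  ν = lam ^ 2 * cf H ^ (2 N.^ suc l)

  ν-fixed : c ν ≡ ν
  ν-fixed = fixed-* (fixed-^ 2 lam-fixed) (fixed-^ (2 N.^ suc l) (trans (cf-conj H H≤K) (cong cf K∸H≡H)))

  norm-fixed : ∀ t → c (c t * t) ≡ c t * t
  norm-fixed t = trans (c-* (c t) t) (trans (cong (_* c t) (c-involutive t)) (*-comm t (c t)))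

  W-middle-sq : ∀ t → (W t H) ^ 2 ≡ ν * (c t * t)
  W-middle-sq t = begin
      (lam * (cf H * M t H) ^ p) ^ 2                 ≡⟨ *-^ _ _ 2 ⟩
      lam ^ 2 * ((cf H * M t H) ^ p) ^ 2             ≡⟨ cong (lam ^ 2 *_) (sym (^-* _ p 2)) ⟩
      lam ^ 2 * (cf H * M t H) ^ (p N.* 2)           ≡⟨ cong (λ k → lam ^ 2 * (cf H * M t H) ^ k) (NP.*-comm p 2) ⟩
      lam ^ 2 * (cf H * M t H) ^ (2 N.^ suc l)       ≡⟨ cong (lam ^ 2 *_) (*-^ (cf H) (M t H) (2 N.^ suc l)) ⟩
      lam ^ 2 * (cf H ^ (2 N.^ suc l) * M t H ^ (2 N.^ suc l))
        ≡⟨ trans (sym (*-assoc _ _ _)) (cong (ν *_) M-power) ⟩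
      ν * (c t * t)                                   ∎
    where
    open ≡-Reasoning
    M-power : M t H ^ (2 N.^ suc l) ≡ c t * t
    M-power = begin
        (t ^ H * c t ^ (K N.∸ H)) ^ (2 N.^ suc l)  ≡⟨ cong (λ k → (t ^ H * c t ^ k) ^ (2 N.^ suc l)) K∸H≡H ⟩
        (t ^ H * c t ^ H) ^ (2 N.^ suc l)          ≡⟨ cong (_^ (2 N.^ suc l)) (sym (*-^ t (c t) H)) ⟩
        ((t * c t) ^ H) ^ (2 N.^ suc l)            ≡⟨ sym (^-* _ H _) ⟩
        (t * c t) ^ (H N.* 2 N.^ suc l)            ≡⟨ cong ((t * c t) ^_) H*2p≡q ⟩
        c (t * c t)                                ≡⟨ cong c (*-comm t (c t)) ⟩
        c (c t * t)                                ≡⟨ norm-fixed t ⟩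
        c t * t                                    ∎

  θ : Carrier
  θ = proj₁ trace-dual

  A-middle : Carrier
  A-middle = θ * ν

  A-middle≢0 : A-middle ≢ 0#
  A-middle≢0 = nz-* (proj₁ (proj₂ trace-dual)) (nz-* (nz-^ 2 lam≢0) (nz-^ (2 N.^ suc l) (cf-nonzero H H≥1 H<K)))
    where
    H<K : H N.< K
    H<K = subst (H N.<_) (sym K≡H+H) (subst (N._< H N.+ H) (NP.+-identityʳ H) (NP.+-monoʳ-< H H≥1))

  middle-trace : ∀ t → Tr (2 N.* m) (A-middle * t ^ (q N.+ 1)) ≡ Tr m (W t H)
  middle-trace t = begin
      Tr (2 N.* m) (θ * ν * t ^ (q N.+ 1))    ≡⟨ cong (λ z → Tr (2 N.* m) (θ * ν * z)) (trans (^-+ t q 1) (cong (c t *_) (*-identityʳ t))) ⟩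
      Tr (2 N.* m) (θ * ν * (c t * t))        ≡⟨ cong (Tr (2 N.* m)) (*-assoc θ ν _) ⟩
      Tr (2 N.* m) (θ * (ν * (c t * t)))      ≡⟨ Tr-relative θ _ (proj₂ (proj₂ trace-dual)) (fixed-* ν-fixed (norm-fixed t)) ⟩
      Tr m (ν * (c t * t))                    ≡⟨ cong (Tr m) (sym (W-middle-sq t)) ⟩
      Tr m ((W t H) ^ 2)                      ≡⟨ Tr-sq-fixed (W t H) (W-middle-fixed t) ⟩
      Tr m (W t H)                            ∎
    where open ≡-Reasoning

  A-outer : ℕ → Carrier
  A-outer i = lam * cf (K N.∸ i) ^ p

  E : ℕ → ℕ
  E i = (q N.∸ 1) N.* (p N.* i N.+ 1) N.+ 1

  outer-term : ∀ t i → i N.≤ K → A-outer i * t ^ E i ≡ W t (K N.∸ i)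
  outer-term t i i≤K = begin
      lam * cf j ^ p * t ^ E i                       ≡⟨ cong (λ z → lam * cf j ^ p * t ^ z) E≡ ⟩
      lam * cf j ^ p * t ^ ((j N.+ q N.* i) N.* p)   ≡⟨ cong (λ z → lam * cf j ^ p * z) (^-* t (j N.+ q N.* i) p) ⟩
      lam * cf j ^ p * (t ^ (j N.+ q N.* i)) ^ p     ≡⟨ cong (λ z → lam * cf j ^ p * z ^ p) monomial ⟩
      lam * cf j ^ p * (M t j) ^ p                   ≡⟨ *-assoc _ _ _ ⟩
      lam * (cf j ^ p * (M t j) ^ p)                 ≡⟨ cong (lam *_) (sym (*-^ (cf j) (M t j) p)) ⟩
      W t j                                          ∎
    where
    open ≡-Reasoning
    j = K N.∸ i
    E≡ : E i ≡ (j N.+ q N.* i) N.* p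
    E≡ = trans (exponent-identity p i j (q N.∸ 1)
                  (trans (cong (p N.*_) (NP.m+[n∸m]≡n i≤K)) (trans (sym q≡p*K) (pow2-suc m))))
               (cong (λ z → (j N.+ z N.* i) N.* p) (sym (pow2-suc m)))
    monomial : t ^ (j N.+ q N.* i) ≡ M t j
    monomial = trans (^-+ t j (q N.* i)) (cong (t ^ j *_) (trans (^-* t q i) (cong (c t ^_) (sym (NP.m∸[m∸n]≡n i≤K)))))

  A : ℕ → Carrier
  A = override H A-middle A-outer

  A-nonzero : ∀ i → 1 N.≤ i → i N.≤ H → A i ≢ 0#
  A-nonzero i i≥1 i≤H = by-cases (i N.≟ H)
    where
    by-cases : Dec (i ≡ H) → A i ≢ 0#
    by-cases (yes i≡H) = subst (λ j → A j ≢ 0#) (sym i≡H) (subst (_≢ 0#) (sym (override-at H A-middle A-outer)) A-middle≢0)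
    by-cases (no i≢H) = subst (_≢ 0#) (sym (override-other H A-middle A-outer i i≢H))
      (nz-* lam≢0 (nz-^ p (cf-nonzero (K N.∸ i) (NP.m<n⇒0<n∸m i<K) (NP.∸-monoʳ-< i≥1 (NP.≤-trans i≤H H≤K)))))
      where
      i<K : i N.< K
      i<K = NP.<-≤-trans (NP.≤∧≢⇒< i≤H i≢H) H≤K

  identity : ∀ t → Tr m (lam * (t + c t) ^ (q N.∸ D N.* p) * (a * t + c a * c t) ^ (D N.* p))
                   ≡ Tr (2 N.* m) (A H * t ^ (q N.+ 1) + sum1to (λ i → A i * t ^ E i) (H N.∸ 1)) + L t
  identity t = begin
      Tr m (lam * (t + c t) ^ (q N.∸ D N.* p) * Z true t ^ (D N.* p))
        ≡⟨ cong (λ x → Tr m (lam * x ^ (q N.∸ D N.* p) * Z true t ^ (D N.* p))) (sym (X-form t)) ⟩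
      Tr m (lam * Z false t ^ (q N.∸ D N.* p) * Z true t ^ (D N.* p))
        ≡⟨ cong (Tr m) (lhs-as-sum t) ⟩
      Tr m (Σ< (W t) (suc K))
        ≡⟨ Tr-fold (W t) H K K≡H+H H≥1 (W-conj t) ⟩
      (Tr m (W t H) + Σ< (λ i → Tr n (W t (K N.∸ suc i))) (H N.∸ 1)) + L t
        ≡⟨ cong (_+ L t) (cong₂ _+_ (trans (sym (middle-trace t)) (cong (λ z → Tr n (z * t ^ (q N.+ 1))) (sym (override-at H A-middle A-outer))))
                                    (Σ<-cong (H N.∸ 1) outer)) ⟩
      (Tr n (A H * t ^ (q N.+ 1)) + Σ< (λ i → Tr n (f (suc i))) (H N.∸ 1)) + L t
        ≡⟨ cong (λ z → (Tr n (A H * t ^ (q N.+ 1)) + z) + L t) (sym (trans (cong (Tr n) (sum1to≡Σ< f (H N.∸ 1))) (Tr-Σ< n (λ i → f (suc i)) (H N.∸ 1)))) ⟩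
      (Tr n (A H * t ^ (q N.+ 1)) + Tr n (sum1to f (H N.∸ 1))) + L t
        ≡⟨ cong (_+ L t) (sym (Tr-+ n _ _)) ⟩
      Tr n (A H * t ^ (q N.+ 1) + sum1to f (H N.∸ 1)) + L t ∎
    where
    open ≡-Reasoning
    n = 2 N.* m
    f : ℕ → Carrier
    f i = A i * t ^ E i
    outer : ∀ i → i N.< H N.∸ 1 → Tr n (W t (K N.∸ suc i)) ≡ Tr n (f (suc i))
    outer i i< = cong (Tr n) (trans (sym (outer-term t (suc i) si≤K)) (cong (_* t ^ E (suc i)) (sym (override-other H A-middle A-outer (suc i) si≢H))))
      where
      si<H : suc i N.< H
      si<H = subst (suc i N.<_) (sym (pow2-suc r₀)) (N.s≤s i<)
      si≢H : suc i ≢ H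
      si≢H = NP.<⇒≢ si<H
      si≤K : suc i N.≤ K
      si≤K = NP.≤-trans (NP.<⇒≤ si<H) H≤K

-- The hypotheses on d = D·2^l with 2^(l+1) ∤ d and 1 ≤ d ≤ 2^m - 1 say that
-- D is odd and 1 ≤ D < 2^(m-l); in particular l < m.
exponent-below : ∀ m l D → 1 N.≤ D N.* 2 N.^ l → D N.* 2 N.^ l N.≤ 2 N.^ m N.∸ 1 → l N.< m
exponent-below m l D d≥1 d≤ with l N.<? m
... | yes l<m = l<m
... | no l≮m = ⊥-elim (NP.<-irrefl refl (NP.<-≤-trans d<2^m 2^m≤d))
  where
  d<2^m : D N.* 2 N.^ l N.< 2 N.^ m
  d<2^m = NP.≤-<-trans d≤ (subst (2 N.^ m N.∸ 1 N.<_) (sym (Digits.pow2-suc m)) (NP.n<1+n _))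
  2^m≤d : 2 N.^ m N.≤ D N.* 2 N.^ l
  2^m≤d = NP.≤-trans (NP.^-monoʳ-≤ 2 (NP.≮⇒≥ l≮m))
    (∣⇒≤ ⦃ ≢-nonZero (λ e → NP.<⇒≢ d≥1 (sym e)) ⦄ (divides D refl))

odd-part-odd : ∀ l D → ¬ (2 N.^ suc l ∣ D N.* 2 N.^ l) → Digits.bit D ≡ true
odd-part-odd l D 2^[l+1]∤d = bit-true (bit D) (bit-half D)
  where
  open Digits
  bit-true : ∀ b → ⟦ b ⟧ N.+ (half D N.+ half D) ≡ D → b ≡ true
  bit-true true _ = refl
  bit-true false D≡ = ⊥-elim (2^[l+1]∤d (divides (half D)
    (trans (cong (N._* 2 N.^ l) (sym D≡)) (solve 2 (λ h p → (h :+ h) :* p := h :* (con 2 :* p)) refl (half D) (2 N.^ l)))))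
    where open +-*-Solver using (solve; _:+_; _:*_; _:=_; con)

m∸l≡suc : ∀ m l → l N.< m → m N.∸ l ≡ suc (m N.∸ l N.∸ 1)
m∸l≡suc m l l<m with m N.∸ l | NP.m<n⇒0<n∸m l<m
... | suc k | _ = refl

m≡l+r : ∀ m l → l N.< m → l N.+ suc (m N.∸ l N.∸ 1) ≡ m
m≡l+r m l l<m = trans (cong (l N.+_) (sym (m∸l≡suc m l l<m))) (NP.m+[n∸m]≡n (NP.<⇒≤ l<m))

odd-part-bound : ∀ m l D → l N.< m → D N.* 2 N.^ l N.≤ 2 N.^ m N.∸ 1 → D N.< 2 N.^ suc (m N.∸ l N.∸ 1)
odd-part-bound m l D l<m d≤ = NP.*-cancelʳ-< (2 N.^ l) D _ (subst₂ N._<_ refl 2^m≡ d<2^m)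
  where
  d<2^m : D N.* 2 N.^ l N.< 2 N.^ m
  d<2^m = NP.≤-<-trans d≤ (subst (2 N.^ m N.∸ 1 N.<_) (sym (Digits.pow2-suc m)) (NP.n<1+n _))
  2^m≡ : 2 N.^ m ≡ 2 N.^ suc (m N.∸ l N.∸ 1) N.* 2 N.^ l
  2^m≡ = trans (cong (2 N.^_) (sym (m≡l+r m l l<m))) (trans (NP.^-distribˡ-+-* 2 l _) (NP.*-comm (2 N.^ l) _))

-- The theorem: the odd part D of d and the lemmas above provide the data of
-- Assembly, whose r₀ = m - l - 1 matches r - 1 in the statement.
lemma1 : (m : ℕ) → 1 N.≤ m → (F : GF2^ (2 N.* m)) → (d l : ℕ) → 1 N.≤ d → d N.≤ 2 N.^ m N.∸ 1 →
         2 N.^ l ∣ d → ¬ (2 N.^ N.suc l ∣ d) →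
         let open GF2^ F in
         (lam : Carrier) → InSub m lam → lam ≢ 0# →
         (a : Carrier) → Primitive a →
         let r = m N.∸ l in
         ∃ λ (A : ℕ → Carrier) → ∃ λ (L : Carrier → Carrier) →
           (∀ i → 1 N.≤ i → i N.≤ 2 N.^ (r N.∸ 1) → A i ≢ 0#) ×
           (∀ x → InF2 (L x)) × (∀ x y → L (x + y) ≡ L x + L y) ×
           (∀ t → gfun m d lam (t + t ^ (2 N.^ m)) (a * t + (a ^ (2 N.^ m)) * t ^ (2 N.^ m))
                ≡ Tr (2 N.* m) (A (2 N.^ (r N.∸ 1)) * t ^ (2 N.^ m N.+ 1)
                     + sum1to (λ i → A i * t ^ ((2 N.^ m N.∸ 1) N.* (2 N.^ (m N.∸ r) N.* i N.+ 1) N.+ 1))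
                              (2 N.^ (r N.∸ 1) N.∸ 1))
                  + L t)
lemma1 m m≥1 F _ l d≥1 d≤ (divides D refl) 2^[l+1]∤d lam lam-fixed lam≢0 a prim
  rewrite NP.m∸[m∸n]≡n (NP.<⇒≤ (exponent-below m l D d≥1 d≤))
        | m∸l≡suc m l (exponent-below m l D d≥1 d≤)
  = A , L , A-nonzero , L-binary , L-additive , identity
  where
  l<m = exponent-below m l D d≥1 d≤
  open Assembly m m≥1 F a prim l (m N.∸ l N.∸ 1) D (sym (m≡l+r m l l<m)) (odd-part-odd l D 2^[l+1]∤d)
                (odd-part-bound m l D l<m d≤) lam lam-fixed lam≢0
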